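{- $\tau(K_{2,3})=2$ and $\tau(K_{2,4})=\tau(K_{2,5})=3$.
   Context: For a graph $G$, $P(G,m)$ is its chromatic polynomial, and the list color function $P_\ell(G,m)$ is the minimum, over all assignments of $m$-element color lists $L(v)$ to the vertices, of the number of proper colorings $f$ with $f(v)\in L(v)$ for all $v$. The list color function threshold $\tau(G)$ is the smallest integer $k\geq\chi(G)$ such that $P_\ell(G,m)=P(G,m)$ for every integer $m\geq k$. -}

module Defs where

open import Data.Nat using (ℕ; zero; suc; _+_; _≤_; _<ᵇ_)
open import Data.Bool using (Bool; true; false; T; _xor_)
open import Data.Fin using (Fin; toℕ)
import Data.Fin as F
open import Data.Fin.Properties using (all?)
open import Data.List using (List; []; _∷_; [_]; map; concatMap; filter; length; allFin)
open import Data.Product using (Σ; _×_; ∃; _,_)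
open import Relation.Nullary using (¬_; Dec)
open import Relation.Binary.PropositionalEquality using (_≡_; _≢_)
open import Relation.Binary using (DecidableEquality)
open import Function.Definitions using (Injective)
open import Data.Bool.Properties using (T?)
open import Relation.Nullary.Decidable using (¬?; _→-dec_)

record Graph : Set where
  field
    n     : ℕ
    adj   : Fin n → Fin n → Bool
    sym   : ∀ u v → adj u v ≡ adj v u
    irrfl : ∀ v → adj v v ≡ false
open Graph public

Proper : (G : Graph) {A : Set} → (Fin (n G) → A) → Set
Proper G f = ∀ u v → T (adj G u v) → f u ≢ f v

proper? : (G : Graph) {A : Set} → DecidableEquality A → (f : Fin (n G) → A) → Dec (Proper G f)
proper? G _≟_ f = all? λ u → all? λ v → T? (adj G u v) →-dec ¬? (f u ≟ f v)

ext : ∀ {k m} → Fin m → (Fin k → Fin m) → Fin (suc k) → Fin m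
ext i f Fin.zero    = i
ext i f (Fin.suc v) = f v

allFuns : (k m : ℕ) → List (Fin k → Fin m)
allFuns zero    m = [ (λ ()) ]
allFuns (suc k) m =
  concatMap (λ f → map (λ i → ext i f) (allFin m)) (allFuns k m)

P : Graph → ℕ → ℕ
P G m = length (filter (λ c → proper? G F._≟_ c) (allFuns (n G) m))

-- An m-list assignment: each vertex v gets a list of m distinct colours,
-- presented as an injective map Fin m → ℕ.
ListAssignment : Graph → ℕ → Set
ListAssignment G m = Σ (Fin (n G) → Fin m → ℕ) λ L → ∀ v → Injective _≡_ _≡_ (L v)

-- number of proper L-colourings (f(v) ∈ L(v)); since each L(v) is
-- injective, choosing f amounts to choosing an index c(v) ∈ Fin m.
numLColorings : (G : Graph) (m : ℕ) → ListAssignment G m → ℕ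
numLColorings G m (L , _) =
  length (filter (λ c → proper? G Data.Nat._≟_ (λ v → L v (c v))) (allFuns (n G) m))

IsListColorFunction : Graph → ℕ → ℕ → Set
IsListColorFunction G m k =
  (Σ (ListAssignment G m) λ L → numLColorings G m L ≡ k)
  × (∀ (L : ListAssignment G m) → k ≤ numLColorings G m L)

Agrees : Graph → ℕ → Set
Agrees G m = IsListColorFunction G m (P G m)

Colorable : Graph → ℕ → Set
Colorable G m = ∃ λ (f : Fin (n G) → Fin m) → Proper G f

IsChromaticNumber : Graph → ℕ → Set
IsChromaticNumber G c = Colorable G c × (∀ m → Colorable G m → c ≤ m)

AgreesFrom : Graph → ℕ → Set
AgreesFrom G k = ∀ m → k ≤ m → Agrees G m

IsTau : Graph → ℕ → Set
IsTau G k = Σ ℕ λ c → IsChromaticNumber G c × c ≤ k × AgreesFrom G k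
  × (∀ k' → c ≤ k' → AgreesFrom G k' → k ≤ k')

Kadj : (a b : ℕ) → Fin (a + b) → Fin (a + b) → Bool
Kadj a b u v = (toℕ u <ᵇ a) xor (toℕ v <ᵇ a)

private
  xor-comm : ∀ x y → x xor y ≡ y xor x
  xor-comm false false = Relation.Binary.PropositionalEquality.refl
  xor-comm false true  = Relation.Binary.PropositionalEquality.refl
  xor-comm true  false = Relation.Binary.PropositionalEquality.refl
  xor-comm true  true  = Relation.Binary.PropositionalEquality.refl
  xor-self : ∀ x → x xor x ≡ false
  xor-self false = Relation.Binary.PropositionalEquality.refl
  xor-self true  = Relation.Binary.PropositionalEquality.refl

K : ℕ → ℕ → Graph
K a b = record
  { n = a + b
  ; adj = Kadj a b
  ; sym = λ u v → xor-comm (toℕ u <ᵇ a) (toℕ v <ᵇ a)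
  ; irrfl = λ v → xor-self (toℕ v <ᵇ a)
  }

module Submission where

open import Data.Nat
open import Data.Nat.Properties
open import Data.Nat.Tactic.RingSolver using (solve-∀)
open import Data.Bool using (Bool; true; false; if_then_else_)
open import Data.Fin using (Fin; zero; suc; toℕ; fromℕ<)
open import Data.Vec.Functional using (Vector; foldr)
open import Data.List using (List; []; _∷_; map; concatMap; filter; length; tabulate; allFin)
open import Data.List.Properties using (map-++; map-tabulate)
import Data.Nat.ListAction as List
open import Data.Nat.ListAction.Properties using (sum-++)
open import Data.Product using (_×_; _,_; proj₁; proj₂)
open import Data.Sum using (_⊎_; inj₁; inj₂)
open import Data.Unit using (tt)
open import Data.Empty using (⊥-elim)
open import Function using (_∘_)
open import Level using (0ℓ)
open import Relation.Nullary using (Dec; yes; no; does; contradiction)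
open import Relation.Nullary.Decidable using (toWitness; _→-dec_)
open import Relation.Unary using (Pred; Decidable)
open import Relation.Binary using (DecidableEquality)
open import Function.Definitions using (Injective)
open import Data.Fin.Properties as Fin using (all?; toℕ-fromℕ<; toℕ-injective)
open import Relation.Binary.PropositionalEquality
open import Defs using (K; Proper; proper?; ext; allFuns; P; ListAssignment; numLColorings; Agrees; AgreesFrom; Colorable; IsChromaticNumber; IsTau)
open import Algebra.Properties.Semiring.Sum +-*-semiring
  using (sum; sum-syntax; sum-cong-≗; ∑-distrib-+; ∑-comm; *-distribˡ-sum; *-distribʳ-sum)

-- Let 0, 1 be the small side of K_{2,b} and L₁, L₂, Lⱼ the lists of 0, 1 and 2 + j, all of size m.
-- Once 0 and 1 receive c₁ ∈ L₁ and c₂ ∈ L₂ the other vertices choose independently, so there are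
-- ∑ ∏ⱼ |Lⱼ ∖ {c₁, c₂}| L-colourings. A factor is at least m - 1 if c₁ = c₂ and m - 2 otherwise, which gives
-- P(K_{2,b}, m) = m (m - 1) ^ b + m (m - 1) (m - 2) ^ b when L₁ and L₂ have all t = m colours in common.
-- If t < m the m - t lost equal pairs must be paid for by factors of distinct pairs exceeding m - 2.
-- Counting the incidences of colours of L₁, L₂ with the Lⱼ shows that over the distinct pairs these
-- excesses add up to at least b m (m - t), which together with Bernoulli's inequality suffices as soon
-- as (m - 1) ^ b ≤ (m - 2) ^ b + b m (m - 2) ^ (b - 1): for m ≥ 3 if b = 3 and m ≥ 4 if b = 4, 5.
-- The remaining cases m = 2, b = 3 and m = 3, b = 4, 5 are split by t: t = m - 1 leaves a single
-- pair of unshared colours, and every list containing both of them misses a common colour; for m = 3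
-- and t ≤ 1 the convexity of d ↦ 2 ^ (b - d) replaces Bernoulli's inequality; for m = 2 and t = 0 the
-- 2 ^ 12 possible incidence patterns are checked. Finally, for b = 4, 5 the lists {1,2}, {3,4} on the
-- small side and {1,3}, {1,4}, {2,3}, {2,4} on the other admit no L-colouring when m = 2.

-- Finite sums and products

sum-const : ∀ n c → ∑[ i < n ] c ≡ n * c
sum-const zero    c = refl
sum-const (suc n) c = cong (c +_) (sum-const n c)

sum-mono-≤ : ∀ {n} {f g : Vector ℕ n} → (∀ i → f i ≤ g i) → sum f ≤ sum g
sum-mono-≤ {zero}  h = z≤n
sum-mono-≤ {suc n} h = +-mono-≤ (h zero) (sum-mono-≤ (λ i → h (suc i)))

term≤sum : ∀ {n} (f : Vector ℕ n) i → f i ≤ sum f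
term≤sum f zero    = m≤m+n _ _
term≤sum f (suc i) = ≤-trans (term≤sum (λ j → f (suc j)) i) (m≤n+m _ _)

∏ : ∀ {n} → Vector ℕ n → ℕ
∏ = foldr _*_ 1

∏-cong : ∀ {n} {f g : Vector ℕ n} → (∀ i → f i ≡ g i) → ∏ f ≡ ∏ g
∏-cong {zero}  h = refl
∏-cong {suc n} h = cong₂ _*_ (h zero) (∏-cong (λ i → h (suc i)))

∏-mono-≤ : ∀ {n} {f g : Vector ℕ n} → (∀ i → f i ≤ g i) → ∏ f ≤ ∏ g
∏-mono-≤ {zero}  h = ≤-refl
∏-mono-≤ {suc n} h = *-mono-≤ (h zero) (∏-mono-≤ (λ i → h (suc i)))

∏-const : ∀ n c → ∏ {n} (λ _ → c) ≡ c ^ n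
∏-const zero    c = refl
∏-const (suc n) c = cong (c *_) (∏-const n c)

∑∑ : ∀ {m} → (Fin m → Fin m → ℕ) → ℕ
∑∑ {m} f = ∑[ i < m ] ∑[ j < m ] f i j

∑∑-cong : ∀ {m} {f g : Fin m → Fin m → ℕ} → (∀ i j → f i j ≡ g i j) → ∑∑ f ≡ ∑∑ g
∑∑-cong h = sum-cong-≗ (λ i → sum-cong-≗ (h i))

∑∑-mono-≤ : ∀ {m} {f g : Fin m → Fin m → ℕ} → (∀ i j → f i j ≤ g i j) → ∑∑ f ≤ ∑∑ g
∑∑-mono-≤ h = sum-mono-≤ (λ i → sum-mono-≤ (h i))

∑∑-distrib-+ : ∀ {m} (f g : Fin m → Fin m → ℕ) → ∑∑ (λ i j → f i j + g i j) ≡ ∑∑ f + ∑∑ g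
∑∑-distrib-+ f g = trans (sum-cong-≗ (λ i → ∑-distrib-+ (f i) (g i))) (∑-distrib-+ (λ i → sum (f i)) (λ i → sum (g i)))

∑∑-*ˡ : ∀ {m} c (f : Fin m → Fin m → ℕ) → ∑∑ (λ i j → c * f i j) ≡ c * ∑∑ f
∑∑-*ˡ c f = trans (sum-cong-≗ (λ i → sym (*-distribˡ-sum c (f i)))) (sym (*-distribˡ-sum c (λ i → sum (f i))))

∑∑-*ʳ : ∀ {m} c (f : Fin m → Fin m → ℕ) → ∑∑ (λ i j → f i j * c) ≡ ∑∑ f * c
∑∑-*ʳ c f = trans (sum-cong-≗ (λ i → sym (*-distribʳ-sum c (f i)))) (sym (*-distribʳ-sum c (λ i → sum (f i))))

∑∑-*-∑ : ∀ {m b} (c : Fin m → Fin m → ℕ) (g : Fin b → Fin m → Fin m → ℕ) →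
         ∑∑ (λ i₁ i₂ → c i₁ i₂ * ∑[ j < b ] g j i₁ i₂) ≡ ∑[ j < b ] ∑∑ (λ i₁ i₂ → c i₁ i₂ * g j i₁ i₂)
∑∑-*-∑ {m} {b} c g = begin
  ∑∑ (λ i₁ i₂ → c i₁ i₂ * ∑[ j < b ] g j i₁ i₂)
    ≡⟨ ∑∑-cong (λ i₁ i₂ → *-distribˡ-sum (c i₁ i₂) (λ j → g j i₁ i₂)) ⟩
  ∑[ i₁ < m ] ∑[ i₂ < m ] ∑[ j < b ] (c i₁ i₂ * g j i₁ i₂)
    ≡⟨ sum-cong-≗ {m} (λ i₁ → ∑-comm (λ i₂ j → c i₁ i₂ * g j i₁ i₂)) ⟩
  ∑[ i₁ < m ] ∑[ j < b ] ∑[ i₂ < m ] (c i₁ i₂ * g j i₁ i₂)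
    ≡⟨ ∑-comm (λ i₁ j → ∑[ i₂ < m ] (c i₁ i₂ * g j i₁ i₂)) ⟩
  ∑[ j < b ] ∑∑ (λ i₁ i₂ → c i₁ i₂ * g j i₁ i₂) ∎
  where open ≡-Reasoning

∑∑-const : ∀ m c → ∑∑ {m} (λ _ _ → c) ≡ m * (m * c)
∑∑-const m c = trans (sum-cong-≗ {m} (λ _ → sum-const m c)) (sum-const m (m * c))

∏-≤1 : ∀ {n} (f : Vector ℕ n) → (∀ j → f j ≤ 1) → ∏ f ≤ 1
∏-≤1 {zero}  f h = ≤-refl
∏-≤1 {suc n} f h = *-mono-≤ (h zero) (∏-≤1 (λ j → f (suc j)) (λ j → h (suc j)))

∏≡1⇒ : ∀ {n} (f : Vector ℕ n) → ∏ f ≡ 1 → ∀ j → f j ≡ 1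
∏≡1⇒ f h zero    = m*n≡1⇒m≡1 (f zero) _ h
∏≡1⇒ f h (suc j) = ∏≡1⇒ (λ j → f (suc j)) (m*n≡1⇒n≡1 (f zero) _ h) j

⇒∏≡1 : ∀ {n} (f : Vector ℕ n) → (∀ j → f j ≡ 1) → ∏ f ≡ 1
⇒∏≡1 {n} f h = trans (∏-cong h) (trans (∏-const n 1) (^-zeroˡ n))

-- Bernoulli-type inequalities

-- Bernoulli's inequality r ^ n + r ^ (n - 1) ∑ y ≤ ∏ (r + y), multiplied by r to avoid r ^ (n - 1).
bernoulli : ∀ r n (y : Vector ℕ n) → r * r ^ n + r ^ n * sum y ≤ r * ∏ (λ j → r + y j)
bernoulli r zero    y = ≤-reflexive (base r)
  where
  base : ∀ r → r * 1 + 1 * 0 ≡ r * 1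
  base = solve-∀
bernoulli r (suc n) y = begin
  r * (r * p) + r * p * (y₀ + S)              ≤⟨ m≤m+n _ _ ⟩
  r * (r * p) + r * p * (y₀ + S) + y₀ * p * S ≡⟨ expand r p y₀ S ⟩
  (r + y₀) * (r * p + p * S)                  ≤⟨ *-monoʳ-≤ (r + y₀) (bernoulli r n (λ j → y (suc j))) ⟩
  (r + y₀) * (r * Π)                          ≡⟨ x*[r*y]≡r*[x*y] (r + y₀) r Π ⟩
  r * ((r + y₀) * Π)                          ∎
  where
  open ≤-Reasoning
  p = r ^ n
  y₀ = y zero
  S = sum (λ j → y (suc j))
  Π = ∏ (λ j → r + y (suc j))
  expand : ∀ r p y₀ S → r * (r * p) + r * p * (y₀ + S) + y₀ * p * S ≡ (r + y₀) * (r * p + p * S)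
  expand = solve-∀
  x*[r*y]≡r*[x*y] : ∀ x r y → x * (r * y) ≡ r * (x * y)
  x*[r*y]≡r*[x*y] = solve-∀

-- ∏ f ≥ R ^ n - R ^ (n - 1) ∑ w, again multiplied by R.
power≤∏+deficit : ∀ R n (f w : Vector ℕ n) → (∀ j → R ≤ f j + w j) → (∀ j → w j ≤ 1) →
                  R * R ^ n ≤ R * ∏ f + R ^ n * sum w
power≤∏+deficit R zero    f w _ _ = ≤-reflexive (base R)
  where
  base : ∀ R → R * 1 ≡ R * 1 + 1 * 0
  base = solve-∀
power≤∏+deficit R (suc n) f w short ≤1 with R ≤? f zero
... | yes R≤f₀ = begin
  R * (R * p)                          ≤⟨ *-monoʳ-≤ R IH ⟩
  R * (R * Π + p * W)                  ≡⟨ expand R Π p W ⟩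
  R * R * Π + R * p * W                ≤⟨ +-mono-≤ (*-monoˡ-≤ Π (*-monoʳ-≤ R R≤f₀)) (*-monoʳ-≤ (R * p) (m≤n+m W (w zero))) ⟩
  R * f zero * Π + R * p * (w zero + W) ≡⟨ cong (_+ R * p * (w zero + W)) (*-assoc R (f zero) Π) ⟩
  R * (f zero * Π) + R * p * (w zero + W) ∎
  where
  open ≤-Reasoning
  p = R ^ n
  Π = ∏ (λ j → f (suc j))
  W = sum (λ j → w (suc j))
  IH = power≤∏+deficit R n (λ j → f (suc j)) (λ j → w (suc j)) (λ j → short (suc j)) (λ j → ≤1 (suc j))
  expand : ∀ R Π p W → R * (R * Π + p * W) ≡ R * R * Π + R * p * W
  expand = solve-∀
... | no R≰f₀ = begin
  R * (R * p)                                  ≡⟨ cong (_* (R * p)) (sym f₀+1≡R) ⟩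
  (f zero + 1) * (R * p)                       ≡⟨ *-distribʳ-+ (R * p) (f zero) 1 ⟩
  f zero * (R * p) + 1 * (R * p)               ≤⟨ +-monoˡ-≤ (1 * (R * p)) (*-monoʳ-≤ (f zero) IH) ⟩
  f zero * (R * Π + p * W) + 1 * (R * p)       ≡⟨ cong (_+ 1 * (R * p)) (*-distribˡ-+ (f zero) (R * Π) (p * W)) ⟩
  f zero * (R * Π) + f zero * (p * W) + 1 * (R * p)
    ≤⟨ +-monoˡ-≤ (1 * (R * p)) (+-monoʳ-≤ (f zero * (R * Π)) (*-monoˡ-≤ (p * W) (<⇒≤ f₀<R))) ⟩
  f zero * (R * Π) + R * (p * W) + 1 * (R * p) ≡⟨ rearrange (f zero) R Π p W ⟩
  R * (f zero * Π) + R * p * (1 + W)           ≡⟨ cong (λ x → R * (f zero * Π) + R * p * (x + W)) (sym w₀≡1) ⟩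
  R * (f zero * Π) + R * p * (w zero + W)      ∎
  where
  open ≤-Reasoning
  p = R ^ n
  Π = ∏ (λ j → f (suc j))
  W = sum (λ j → w (suc j))
  IH = power≤∏+deficit R n (λ j → f (suc j)) (λ j → w (suc j)) (λ j → short (suc j)) (λ j → ≤1 (suc j))
  f₀<R : f zero < R
  f₀<R = ≰⇒> R≰f₀
  w₀≡1 : w zero ≡ 1
  w₀≡1 = ≤-antisym (≤1 zero) (+-cancelˡ-≤ (f zero) 1 (w zero) (≤-trans (≤-reflexive (+-comm (f zero) 1)) (≤-trans f₀<R (short zero))))
  f₀+1≡R : f zero + 1 ≡ R
  f₀+1≡R = ≤-antisym (≤-trans (≤-reflexive (+-comm (f zero) 1)) f₀<R) (subst (λ x → R ≤ f zero + x) w₀≡1 (short zero))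
  rearrange : ∀ a R Π p W → a * (R * Π) + R * (p * W) + 1 * (R * p) ≡ R * (a * Π) + R * p * (1 + W)
  rearrange = solve-∀

2^n≤∏*2^∑ : ∀ n (f w : Vector ℕ n) → (∀ j → 2 ≤ f j + w j) → (∀ j → w j ≤ 1) → 2 ^ n ≤ ∏ f * 2 ^ sum w
2^n≤∏*2^∑ zero    f w _ _ = ≤-refl
2^n≤∏*2^∑ (suc n) f w short ≤1 = begin
  2 * 2 ^ n                                   ≤⟨ *-mono-≤ (factor (short zero) (≤1 zero)) IH ⟩
  (f zero * 2 ^ w zero) * (Π * 2 ^ W)         ≡⟨ interchange (f zero) (2 ^ w zero) Π (2 ^ W) ⟩
  f zero * Π * (2 ^ w zero * 2 ^ W)           ≡⟨ cong (f zero * Π *_) (sym (^-distribˡ-+-* 2 (w zero) W)) ⟩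
  f zero * Π * 2 ^ (w zero + W)               ∎
  where
  open ≤-Reasoning
  Π = ∏ (λ j → f (suc j))
  W = sum (λ j → w (suc j))
  IH = 2^n≤∏*2^∑ n (λ j → f (suc j)) (λ j → w (suc j)) (λ j → short (suc j)) (λ j → ≤1 (suc j))
  interchange : ∀ a b c d → a * b * (c * d) ≡ a * c * (b * d)
  interchange = solve-∀
  factor : ∀ {x v} → 2 ≤ x + v → v ≤ 1 → 2 ≤ x * 2 ^ v
  factor {x}     {zero}  h _ = subst (2 ≤_) (trans (+-identityʳ x) (sym (*-identityʳ x))) h
  factor {suc x} {suc zero} _ _ = *-monoˡ-≤ 2 (s≤s (z≤n {x}))
  factor {zero}  {suc zero} (s≤s ()) _
  factor {x}     {suc (suc v)} _ (s≤s ())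

-- Arithmetic of the individual cases

≤1⇒≡0⊎≡1 : ∀ {x} → x ≤ 1 → x ≡ 0 ⊎ x ≡ 1
≤1⇒≡0⊎≡1 z≤n       = inj₁ refl
≤1⇒≡0⊎≡1 (s≤s z≤n) = inj₂ refl

x+y≤1+x*y : ∀ x y → x ≤ 1 → y ≤ 1 → x + y ≤ 1 + x * y
x+y≤1+x*y x y x≤1 y≤1 with ≤1⇒≡0⊎≡1 x≤1 | ≤1⇒≡0⊎≡1 y≤1
... | inj₁ refl | inj₁ refl = z≤n
... | inj₁ refl | inj₂ refl = ≤-refl
... | inj₂ refl | inj₁ refl = ≤-refl
... | inj₂ refl | inj₂ refl = ≤-refl

x*y≤x : ∀ x y → y ≤ 1 → x * y ≤ x
x*y≤x x y y≤1 = ≤-trans (*-monoʳ-≤ x y≤1) (≤-reflexive (*-identityʳ x))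

x+y≡2+r⇒x≡1+r+[1-y] : ∀ {x y} r → x + y ≡ 2 + r → y ≤ 1 → x ≡ suc r + (1 ∸ y)
x+y≡2+r⇒x≡1+r+[1-y] {x} r h z≤n       = trans (sym (+-identityʳ x)) (trans h (+-comm 1 (suc r)))
x+y≡2+r⇒x≡1+r+[1-y] {x} r h (s≤s z≤n) = +-cancelʳ-≡ 1 x (suc r + 0) (trans h (cong suc (sym (trans (cong (_+ 1) (+-identityʳ r)) (+-comm r 1)))))

-- P (K 2 b) at m = 2 + r is m (m - 1) ^ b + m (m - 1) (m - 2) ^ b.
P-K₂ : ℕ → ℕ → ℕ
P-K₂ b r = (2 + r) * (1 + r) ^ b + (2 + r) * (1 + r) * r ^ b

m[m-1]+m≡m² : ∀ r → (2 + r) * (1 + r) + (2 + r) ≡ (2 + r) * (2 + r)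
m[m-1]+m≡m² = solve-∀

-- The arithmetic of excessⱼ-lower: Y + m t ≥ m ^ 2 + r (t - s) ≥ m ^ 2.
m²≤Y+m*t : ∀ r Q t s D Y ab →
           D + s ≡ (2 + r) * t →
           D + (r * Q + Y) + (2 + r) * ab ≡ (2 + r) * (2 + r) * (2 + r) + s →
           ab ≤ (2 + r) + s → s ≤ t → Q + t ≡ (2 + r) * (2 + r) →
           (2 + r) * (2 + r) ≤ Y + (2 + r) * t
m²≤Y+m*t r Q t s D Y ab hD hZ hab s≤t hQ = begin
  M * M                 ≡⟨ sym hQ ⟩
  Q + t                 ≤⟨ +-monoˡ-≤ t (+-cancelʳ-≤ (2 * s) _ _ step₄) ⟩
  Y + t + r * t + t     ≡⟨ eq₅ Y t r ⟩
  Y + M * t             ∎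
  where
  open ≤-Reasoning
  M = 2 + r
  eq₁ : ∀ r Q t s → (Q + 2 * s) + (r * Q + Q + (2 + r) * t) ≡ (2 + r) * (Q + t) + s + s
  eq₁ = solve-∀
  eq₂ : ∀ D X M s → D + X + M * (M + s) + s ≡ (D + s) + X + (M * M + M * s)
  eq₂ = solve-∀
  eq₃ : ∀ r Q t s Y → (2 + r) * t + (r * Q + Y) + (Q + t + (2 + r) * s) ≡ (Y + t + (2 + r) * s) + (r * Q + Q + (2 + r) * t)
  eq₃ = solve-∀
  eq₄ : ∀ Y t r s → Y + t + (2 + r) * s ≡ (Y + t + r * s) + 2 * s
  eq₄ = solve-∀
  eq₅ : ∀ Y t r → Y + t + r * t + t ≡ Y + (2 + r) * t
  eq₅ = solve-∀
  step₁ : M * M * M + s ≤ D + (r * Q + Y) + M * (M + s)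
  step₁ = begin
    M * M * M + s                ≡⟨ sym hZ ⟩
    D + (r * Q + Y) + M * ab     ≤⟨ +-monoʳ-≤ (D + (r * Q + Y)) (*-monoʳ-≤ M hab) ⟩
    D + (r * Q + Y) + M * (M + s) ∎
  step₂ : (Q + 2 * s) + (r * Q + Q + M * t) ≤ (Y + t + M * s) + (r * Q + Q + M * t)
  step₂ = begin
    (Q + 2 * s) + (r * Q + Q + M * t)           ≡⟨ eq₁ r Q t s ⟩
    M * (Q + t) + s + s                         ≡⟨ cong (λ x → M * x + s + s) hQ ⟩
    M * (M * M) + s + s                         ≡⟨ cong (λ x → x + s + s) (sym (*-assoc M M M)) ⟩
    M * M * M + s + s                           ≤⟨ +-monoˡ-≤ s step₁ ⟩
    D + (r * Q + Y) + M * (M + s) + s           ≡⟨ eq₂ D (r * Q + Y) M s ⟩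
    (D + s) + (r * Q + Y) + (M * M + M * s)     ≡⟨ cong₂ (λ u v → u + (r * Q + Y) + (v + M * s)) hD (sym hQ) ⟩
    M * t + (r * Q + Y) + (Q + t + M * s)       ≡⟨ eq₃ r Q t s Y ⟩
    (Y + t + M * s) + (r * Q + Q + M * t)       ∎
  step₃ : Q + 2 * s ≤ Y + t + M * s
  step₃ = +-cancelʳ-≤ (r * Q + Q + M * t) _ _ step₂
  step₄ : Q + 2 * s ≤ (Y + t + r * t) + 2 * s
  step₄ = begin
    Q + 2 * s                 ≤⟨ step₃ ⟩
    Y + t + M * s             ≡⟨ eq₄ Y t r s ⟩
    (Y + t + r * s) + 2 * s   ≤⟨ +-monoˡ-≤ (2 * s) (+-monoʳ-≤ (Y + t) (*-monoʳ-≤ r s≤t)) ⟩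
    (Y + t + r * t) + 2 * s   ∎
-- Writing t + k = m, the k missing common colours are paid for by the excess of the distinct pairs,
-- provided each costs no more than b m r ^ b, which is the hypothesis on r and b.
P-K₂≤-linear : ∀ r b t Q SY N → 1 ≤ r →
               t * (r * suc r ^ b) + Q * (r * r ^ b) + r ^ b * SY ≤ r * N →
               b * ((2 + r) * (2 + r)) ≤ SY + b * ((2 + r) * t) →
               Q + t ≡ (2 + r) * (2 + r) → t ≤ 2 + r →
               r * suc r ^ b ≤ r * r ^ b + b * (2 + r) * r ^ b →
               P-K₂ b r ≤ N
P-K₂≤-linear r b t Q SY N 1≤r hN hSY hQ t≤M hrb = *-cancelˡ-≤ r {{>-nonZero 1≤r}} (begin
  r * (M * R₁ + Qs * Rb)                            ≡⟨ cong (λ x → r * (x * R₁ + Qs * Rb)) (sym t+k≡M) ⟩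
  r * ((t + k) * R₁ + Qs * Rb)                      ≡⟨ e₂ r t k R₁ Qs Rb ⟩
  t * (r * R₁) + Qs * (r * Rb) + k * (r * R₁)       ≤⟨ +-monoʳ-≤ _ (*-monoʳ-≤ k hrb) ⟩
  t * (r * R₁) + Qs * (r * Rb) + k * (r * Rb + b * M * Rb) ≡⟨ e₃ t r R₁ Qs Rb k b M ⟩
  t * (r * R₁) + (Qs + k) * (r * Rb) + Rb * (b * M * k)    ≤⟨ +-monoʳ-≤ _ (*-monoʳ-≤ Rb bMk≤SY) ⟩
  t * (r * R₁) + (Qs + k) * (r * Rb) + Rb * SY      ≡⟨ cong (λ x → t * (r * R₁) + x * (r * Rb) + Rb * SY) (sym Q≡Qs+k) ⟩
  t * (r * R₁) + Q * (r * Rb) + Rb * SY             ≤⟨ hN ⟩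
  r * N                                             ∎)
  where
  open ≤-Reasoning
  M = 2 + r
  R₁ = suc r ^ b
  Rb = r ^ b
  Qs = (2 + r) * (1 + r)
  k = M ∸ t
  e₀ : ∀ Qs t k → Qs + (t + k) ≡ Qs + k + t
  e₀ = solve-∀
  e₁ : ∀ b M k t → b * M * k + b * (M * t) ≡ b * (M * (t + k))
  e₁ = solve-∀
  e₂ : ∀ r t k R₁ Qs Rb → r * ((t + k) * R₁ + Qs * Rb) ≡ t * (r * R₁) + Qs * (r * Rb) + k * (r * R₁)
  e₂ = solve-∀
  e₃ : ∀ t r R₁ Qs Rb k b M → t * (r * R₁) + Qs * (r * Rb) + k * (r * Rb + b * M * Rb)
                             ≡ t * (r * R₁) + (Qs + k) * (r * Rb) + Rb * (b * M * k)
  e₃ = solve-∀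
  t+k≡M : t + k ≡ M
  t+k≡M = m+[n∸m]≡n t≤M
  Q≡Qs+k : Q ≡ Qs + k
  Q≡Qs+k = +-cancelʳ-≡ t Q (Qs + k) (begin-equality
    Q + t          ≡⟨ hQ ⟩
    M * M          ≡⟨ sym (m[m-1]+m≡m² r) ⟩
    Qs + M         ≡⟨ cong (Qs +_) (sym t+k≡M) ⟩
    Qs + (t + k)   ≡⟨ e₀ Qs t k ⟩
    Qs + k + t     ∎)
  bMk≤SY : b * M * k ≤ SY
  bMk≤SY = +-cancelʳ-≤ (b * (M * t)) _ _ (begin
    b * M * k + b * (M * t) ≡⟨ e₁ b M k t ⟩
    b * (M * (t + k))       ≡⟨ cong (λ x → b * (M * x)) t+k≡M ⟩
    b * (M * M)             ≤⟨ hSY ⟩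
    SY + b * (M * t)        ∎)

bit-cases-≤ : ∀ E F X Y Z T → E ≤ 1 → F ≤ 1 → E * F ≡ 0 →
              (E ≡ 1 → X ≤ T) → (E ≡ 0 → F ≡ 1 → Y ≤ T) → (E ≡ 0 → F ≡ 0 → Z ≤ T) →
              E * X + F * Y + (1 ∸ (E + F)) * Z ≤ T
bit-cases-≤ E F X Y Z T E≤1 F≤1 EF≡0 case₁ case₂ case₃ with ≤1⇒≡0⊎≡1 E≤1 | ≤1⇒≡0⊎≡1 F≤1
... | inj₁ refl | inj₁ refl = subst (_≤ T) (sym (only₃ X Y Z)) (case₃ refl refl)
  where
  only₃ : ∀ X Y Z → 0 * X + 0 * Y + 1 * Z ≡ Z
  only₃ = solve-∀
... | inj₁ refl | inj₂ refl = subst (_≤ T) (sym (only₂ X Y Z)) (case₂ refl refl)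
  where
  only₂ : ∀ X Y Z → 0 * X + 1 * Y + 0 * Z ≡ Y
  only₂ = solve-∀
... | inj₂ refl | inj₁ refl = subst (_≤ T) (sym (only₁ X Y Z)) (case₁ refl)
  where
  only₁ : ∀ X Y Z → 1 * X + 0 * Y + 0 * Z ≡ X
  only₁ = solve-∀
... | inj₂ refl | inj₂ refl with () ← EF≡0

a*b+s≤t : ∀ s a b t → a ≤ 1 → b ≤ 1 → s ≤ t → (s + a) + (s + b) ≤ suc t + s → a * b + s ≤ t
a*b+s≤t s zero          b             t _ _ s≤t _ = s≤t
a*b+s≤t s (suc zero)    zero          t _ _ s≤t _ = s≤t
a*b+s≤t s (suc zero)    (suc zero)    t _ _ _   h = +-cancelʳ-≤ (suc s) _ _ (subst₂ _≤_ (eq₁ s) (eq₂ t s) h)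
  where
  eq₁ : ∀ s → s + 1 + (s + 1) ≡ 1 + s + suc s
  eq₁ = solve-∀
  eq₂ : ∀ t s → suc t + s ≡ t + suc s
  eq₂ = solve-∀
a*b+s≤t s (suc (suc a)) b             t (s≤s ()) _ _ _
a*b+s≤t s (suc zero)    (suc (suc b)) t _ (s≤s ()) _ _

P-K₂≤-diagonal : ∀ r b EB FW Qo N → Qo + (2 + r) ≡ (2 + r) * (2 + r) →
                 suc r * (suc r * suc r ^ b) + suc r ^ b * EB + 1 * (suc r * suc r ^ b) + Qo * (suc r * r ^ b)
                   ≤ suc r * N + suc r ^ b * FW →
                 FW ≤ EB → P-K₂ b r ≤ N
P-K₂≤-diagonal r b EB FW Qo N hQo h FW≤EB = *-cancelˡ-≤ (suc r) (+-cancelʳ-≤ (R₁ * EB) _ _ (begin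
  suc r * P-K₂ b r + R₁ * EB                                               ≡⟨ cong (λ Q → suc r * ((2 + r) * R₁ + Q * r ^ b) + R₁ * EB) (sym Qo≡) ⟩
  suc r * ((2 + r) * R₁ + Qo * r ^ b) + R₁ * EB                             ≡⟨ expand r R₁ EB Qo (r ^ b) ⟩
  suc r * (suc r * R₁) + R₁ * EB + 1 * (suc r * R₁) + Qo * (suc r * r ^ b) ≤⟨ h ⟩
  suc r * N + R₁ * FW                                                       ≤⟨ +-monoʳ-≤ (suc r * N) (*-monoʳ-≤ R₁ FW≤EB) ⟩
  suc r * N + R₁ * EB                                                       ∎))
  where
  open ≤-Reasoning
  R₁ = suc r ^ b
  expand : ∀ r R₁ EB Qo p → suc r * ((2 + r) * R₁ + Qo * p) + R₁ * EB
                            ≡ suc r * (suc r * R₁) + R₁ * EB + 1 * (suc r * R₁) + Qo * (suc r * p)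
  expand = solve-∀
  Qo≡ : Qo ≡ (2 + r) * (1 + r)
  Qo≡ = +-cancelʳ-≡ (2 + r) _ _ (trans hQo (sym (m[m-1]+m≡m² r)))

a+c≤3⇒a*c≤2 : ∀ a c → a + c ≤ 3 → a * c ≤ 2
a+c≤3⇒a*c≤2 0             c             _ = z≤n
a+c≤3⇒a*c≤2 1             c             h = ≤-trans (≤-reflexive (+-identityʳ c)) (≤-pred h)
a+c≤3⇒a*c≤2 2             0             _ = z≤n
a+c≤3⇒a*c≤2 2             1             _ = ≤-refl
a+c≤3⇒a*c≤2 3             0             _ = z≤n
a+c≤3⇒a*c≤2 2             (suc (suc c)) (s≤s (s≤s (s≤s ())))
a+c≤3⇒a*c≤2 3             (suc c)       (s≤s (s≤s (s≤s ())))
a+c≤3⇒a*c≤2 (suc (suc (suc (suc a)))) c (s≤s (s≤s (s≤s ())))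

a+c≤4⇒a*c≤4 : ∀ a c → a + c ≤ 4 → a * c ≤ 4
a+c≤4⇒a*c≤4 0             c             _ = z≤n
a+c≤4⇒a*c≤4 1             c             h = ≤-trans (≤-reflexive (+-identityʳ c)) (≤-trans (n≤1+n c) h)
a+c≤4⇒a*c≤4 2             0             _ = z≤n
a+c≤4⇒a*c≤4 2             1             _ = s≤s (s≤s z≤n)
a+c≤4⇒a*c≤4 2             2             _ = ≤-refl
a+c≤4⇒a*c≤4 3             0             _ = z≤n
a+c≤4⇒a*c≤4 3             1             _ = s≤s (s≤s (s≤s z≤n))
a+c≤4⇒a*c≤4 4             0             _ = z≤n
a+c≤4⇒a*c≤4 2             (suc (suc (suc c))) (s≤s (s≤s (s≤s (s≤s ()))))
a+c≤4⇒a*c≤4 3             (suc (suc c)) (s≤s (s≤s (s≤s (s≤s ()))))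
a+c≤4⇒a*c≤4 4             (suc c)       (s≤s (s≤s (s≤s (s≤s ()))))
a+c≤4⇒a*c≤4 (suc (suc (suc (suc (suc a))))) c (s≤s (s≤s (s≤s (s≤s ()))))

κ+s≡a*c⇒κ≤2+t : ∀ κ s a c t → κ + s ≡ a * c → a + c ≤ 3 + s → s ≤ t → t ≤ 1 → κ ≤ 2 + t
κ+s≡a*c⇒κ≤2+t κ 0 a c t h a+c≤ _ _ = begin
  κ       ≡⟨ trans (sym (+-identityʳ κ)) h ⟩
  a * c   ≤⟨ a+c≤3⇒a*c≤2 a c (≤-trans a+c≤ (≤-reflexive (+-identityʳ 3))) ⟩
  2       ≤⟨ m≤m+n 2 t ⟩
  2 + t   ∎
  where open ≤-Reasoning
κ+s≡a*c⇒κ≤2+t κ 1 a c 1 h a+c≤ _ _ = +-cancelʳ-≤ 1 κ 3 (≤-trans (≤-reflexive h) (a+c≤4⇒a*c≤4 a c a+c≤))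
κ+s≡a*c⇒κ≤2+t κ 1 a c 0 h a+c≤ () _
κ+s≡a*c⇒κ≤2+t κ 1 a c (suc (suc t)) h a+c≤ _ (s≤s ())
κ+s≡a*c⇒κ≤2+t κ (suc (suc s)) a c t h a+c≤ s≤t t≤1 with s≤s () ← ≤-trans s≤t t≤1

≤2+r-cases : ∀ {t} r → t ≤ 2 + r → t ≡ 2 + r ⊎ t ≡ 1 + r ⊎ t ≤ r
≤2+r-cases r t≤2+r with m≤n⇒m<n∨m≡n t≤2+r
... | inj₂ t≡2+r = inj₁ t≡2+r
... | inj₁ (s≤s t≤1+r) with m≤n⇒m<n∨m≡n t≤1+r
... | inj₂ t≡1+r = inj₂ (inj₁ t≡1+r)
... | inj₁ (s≤s t≤r) = inj₂ (inj₂ t≤r)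

-- The condition of P-K₂≤N-linear, i.e. (1 + r) ^ b ≤ r ^ b + b (2 + r) r ^ (b - 1), for b = 3, 4, 5.
slack₃ : ∀ x → suc x * (2 + x) ^ 3 ≤ suc x * suc x ^ 3 + 3 * (2 + suc x) * suc x ^ 3
slack₃ x = ≤-trans (m≤m+n _ _) (≤-reflexive (expand x))
  where
  expand : ∀ x → (1 + x) * ((2 + x) * ((2 + x) * ((2 + x) * 1))) + (2 + 14 * x + 24 * x * x + 15 * x * x * x + 3 * x * x * x * x)
                 ≡ (1 + x) * ((1 + x) * ((1 + x) * ((1 + x) * 1))) + 3 * (2 + (1 + x)) * ((1 + x) * ((1 + x) * ((1 + x) * 1)))
  expand = solve-∀

slack₄ : ∀ x → (2 + x) * (3 + x) ^ 4 ≤ (2 + x) * (2 + x) ^ 4 + 4 * (2 + (2 + x)) * (2 + x) ^ 4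
slack₄ x = ≤-trans (m≤m+n _ _) (≤-reflexive (expand x))
  where
  expand : ∀ x → (2 + x) * ((3 + x) * ((3 + x) * ((3 + x) * ((3 + x) * 1))))
                   + (126 + 359 * x + 376 * x * x + 186 * x * x * x + 44 * x * x * x * x + 4 * x * x * x * x * x)
                 ≡ (2 + x) * ((2 + x) * ((2 + x) * ((2 + x) * ((2 + x) * 1))))
                   + 4 * (2 + (2 + x)) * ((2 + x) * ((2 + x) * ((2 + x) * ((2 + x) * 1))))
  expand = solve-∀

slack₅ : ∀ x → (2 + x) * (3 + x) ^ 5 ≤ (2 + x) * (2 + x) ^ 5 + 5 * (2 + (2 + x)) * (2 + x) ^ 5
slack₅ x = ≤-trans (m≤m+n _ _) (≤-reflexive (expand x))
  where
  expand : ∀ x → (2 + x) * ((3 + x) * ((3 + x) * ((3 + x) * ((3 + x) * ((3 + x) * 1)))))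
                   + (218 + 899 * x + 1295 * x * x + 910 * x * x * x + 340 * x * x * x * x + 65 * x * x * x * x * x
                      + 5 * x * x * x * x * x * x)
                 ≡ (2 + x) * ((2 + x) * ((2 + x) * ((2 + x) * ((2 + x) * ((2 + x) * 1)))))
                   + 5 * (2 + (2 + x)) * ((2 + x) * ((2 + x) * ((2 + x) * ((2 + x) * ((2 + x) * 1)))))
  expand = solve-∀

-- Tangent lines of d ↦ 2 ^ (b - d) for b = 4, 5.
tangent₄ : ∀ w d → 2 ^ 4 ≤ w * 2 ^ d → 12 ≤ w + 4 * d
tangent₄ w 0 h = ≤-trans (m≤m+n 12 4) (≤-trans h (≤-trans (≤-reflexive (*-identityʳ w)) (m≤m+n w 0)))
tangent₄ w 1 h = +-monoˡ-≤ 4 (*-cancelʳ-≤ 8 w 2 h)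
tangent₄ w 2 h = +-monoˡ-≤ 8 (*-cancelʳ-≤ 4 w 4 h)
tangent₄ w (suc (suc (suc d))) _ = ≤-trans (*-monoʳ-≤ 4 (s≤s (s≤s (s≤s (z≤n {d}))))) (m≤n+m _ w)

tangent₅ : ∀ w d → 2 ^ 5 ≤ w * 2 ^ d → 24 ≤ w + 8 * d
tangent₅ w 0 h = ≤-trans (m≤m+n 24 8) (≤-trans h (≤-trans (≤-reflexive (*-identityʳ w)) (m≤m+n w 0)))
tangent₅ w 1 h = +-monoˡ-≤ 8 (*-cancelʳ-≤ 16 w 2 h)
tangent₅ w 2 h = +-monoˡ-≤ 16 (*-cancelʳ-≤ 8 w 4 h)
tangent₅ w (suc (suc (suc d))) _ = ≤-trans (*-monoʳ-≤ 8 (s≤s (s≤s (s≤s (z≤n {d}))))) (m≤n+m _ w)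

-- The two cases t = common = 0, 1 of N-lower-m≡3, where Q = distinct.
P-K₂≤-m≡3 : ∀ b c v t Q N → t ≤ 1 → Q + t ≡ 9 →
            (9 * v ≤ N + c * (b * 2) → P-K₂ b 1 ≤ N) →
            (2 ^ b + 8 * v ≤ N + c * (b * 3) → P-K₂ b 1 ≤ N) →
            t * 2 ^ b + Q * v ≤ N + c * (b * (2 + t)) → P-K₂ b 1 ≤ N
P-K₂≤-m≡3 b c v 0 Q N _ Q+0≡9 case₀ _ h = case₀ (subst (λ Q → Q * v ≤ N + c * (b * 2)) (trans (sym (+-identityʳ Q)) Q+0≡9) h)
P-K₂≤-m≡3 b c v 1 Q N _ Q+1≡9 _ case₁ h =
  case₁ (subst₂ (λ x Q → x + Q * v ≤ N + c * (b * 3)) (+-identityʳ (2 ^ b)) (+-cancelʳ-≡ 1 Q 8 Q+1≡9) h)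
P-K₂≤-m≡3 b c v (suc (suc t)) Q N (s≤s ()) _ _ _ _

matrix₃ₓ₂ : ∀ {X : Set} → X → X → X → X → X → X → Fin 3 → Fin 2 → X
matrix₃ₓ₂ x₀₀ x₀₁ x₁₀ x₁₁ x₂₀ x₂₁ zero                zero       = x₀₀
matrix₃ₓ₂ x₀₀ x₀₁ x₁₀ x₁₁ x₂₀ x₂₁ zero                (suc zero) = x₀₁
matrix₃ₓ₂ x₀₀ x₀₁ x₁₀ x₁₁ x₂₀ x₂₁ (suc zero)          zero       = x₁₀
matrix₃ₓ₂ x₀₀ x₀₁ x₁₀ x₁₁ x₂₀ x₂₁ (suc zero)          (suc zero) = x₁₁
matrix₃ₓ₂ x₀₀ x₀₁ x₁₀ x₁₁ x₂₀ x₂₁ (suc (suc zero))    zero       = x₂₀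
matrix₃ₓ₂ x₀₀ x₀₁ x₁₀ x₁₁ x₂₀ x₂₁ (suc (suc zero))    (suc zero) = x₂₁

matrix₃ₓ₂-entries : ∀ {X : Set} (f : Fin 3 → Fin 2 → X) j i →
  matrix₃ₓ₂ (f zero zero) (f zero (suc zero)) (f (suc zero) zero) (f (suc zero) (suc zero))
            (f (suc (suc zero)) zero) (f (suc (suc zero)) (suc zero)) j i ≡ f j i
matrix₃ₓ₂-entries f zero             zero       = refl
matrix₃ₓ₂-entries f zero             (suc zero) = refl
matrix₃ₓ₂-entries f (suc zero)       zero       = refl
matrix₃ₓ₂-entries f (suc zero)       (suc zero) = refl
matrix₃ₓ₂-entries f (suc (suc zero)) zero       = refl
matrix₃ₓ₂-entries f (suc (suc zero)) (suc zero) = refl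

-- With m = 2, b = 3 and no common colour, the weight of a pair is ∏ (2 - [c₁ ∈ Lⱼ] - [c₂ ∈ Lⱼ]);
-- the bound N ≥ 2 is checked over all 2 ^ 12 membership patterns.
N₂,₃ : (u v : Fin 3 → Fin 2 → ℕ) → ℕ
N₂,₃ u v = ∑∑ (λ i₁ i₂ → ∏ (λ j → 2 ∸ (u j i₁ + v j i₂)))

AdmissibleRows : (u v : Fin 3 → Fin 2 → ℕ) → Set
AdmissibleRows u v = ∀ j → u j zero + u j (suc zero) + (v j zero + v j (suc zero)) ≤ 2

bits : (Fin 3 → Fin 2 → Fin 2) → Fin 3 → Fin 2 → ℕ
bits u j i = toℕ (u j i)

Checked : (u v : Fin 3 → Fin 2 → Fin 2) → Set
Checked u v = AdmissibleRows (bits u) (bits v) → 2 ≤ N₂,₃ (bits u) (bits v)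

all-checked : ∀ x₀₀ x₀₁ x₁₀ x₁₁ x₂₀ x₂₁ y₀₀ y₀₁ y₁₀ y₁₁ y₂₀ y₂₁ →
              Checked (matrix₃ₓ₂ x₀₀ x₀₁ x₁₀ x₁₁ x₂₀ x₂₁) (matrix₃ₓ₂ y₀₀ y₀₁ y₁₀ y₁₁ y₂₀ y₂₁)
all-checked = toWitness {a? = all? λ x₀₀ → all? λ x₀₁ → all? λ x₁₀ → all? λ x₁₁ → all? λ x₂₀ → all? λ x₂₁ →
                              all? λ y₀₀ → all? λ y₀₁ → all? λ y₁₀ → all? λ y₁₁ → all? λ y₂₀ → all? λ y₂₁ →
                              check (matrix₃ₓ₂ x₀₀ x₀₁ x₁₀ x₁₁ x₂₀ x₂₁) (matrix₃ₓ₂ y₀₀ y₀₁ y₁₀ y₁₁ y₂₀ y₂₁)} _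
  where
  check : ∀ u v → Dec (Checked u v)
  check u v = all? (λ j → _ ≤? 2) →-dec (2 ≤? _)

2≤N₂,₃ : ∀ (u v : Fin 3 → Fin 2 → Fin 2) → Checked u v
2≤N₂,₃ u v admissible = subst (2 ≤_) (N₂,₃-cong (entries u) (entries v)) (all-checked
    (u zero zero) (u zero (suc zero)) (u (suc zero) zero) (u (suc zero) (suc zero)) (u (suc (suc zero)) zero) (u (suc (suc zero)) (suc zero))
    (v zero zero) (v zero (suc zero)) (v (suc zero) zero) (v (suc zero) (suc zero)) (v (suc (suc zero)) zero) (v (suc (suc zero)) (suc zero))
    (λ j → subst (_≤ 2) (sym (row-cong j)) (admissible j)))
  where
  entries : ∀ w j i → bits (matrix₃ₓ₂ (w zero zero) (w zero (suc zero)) (w (suc zero) zero) (w (suc zero) (suc zero))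
                                       (w (suc (suc zero)) zero) (w (suc (suc zero)) (suc zero))) j i ≡ bits w j i
  entries w j i = cong toℕ (matrix₃ₓ₂-entries w j i)
  N₂,₃-cong : ∀ {u u' v v'} → (∀ j i → u j i ≡ u' j i) → (∀ j i → v j i ≡ v' j i) → N₂,₃ u v ≡ N₂,₃ u' v'
  N₂,₃-cong eu ev = ∑∑-cong (λ i₁ i₂ → ∏-cong (λ j → cong₂ (λ x y → 2 ∸ (x + y)) (eu j i₁) (ev j i₂)))
  row-cong : ∀ j → _ ≡ bits u j zero + bits u j (suc zero) + (bits v j zero + bits v j (suc zero))
  row-cong j = cong₂ _+_ (cong₂ _+_ (entries u j zero) (entries u j (suc zero))) (cong₂ _+_ (entries v j zero) (entries v j (suc zero)))

-- Counting L-colourings of K 2 b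

indicator : Bool → ℕ
indicator true  = 1
indicator false = 0

length-filter≡∑indicator : ∀ {A : Set} {P : Pred A 0ℓ} (P? : Decidable P) xs →
                           length (filter P? xs) ≡ List.sum (map (λ x → indicator (does (P? x))) xs)
length-filter≡∑indicator P? []       = refl
length-filter≡∑indicator P? (x ∷ xs) with P? x
... | yes _ = cong suc (length-filter≡∑indicator P? xs)
... | no  _ = length-filter≡∑indicator P? xs

sum-map-cong : ∀ {A : Set} {F G : A → ℕ} → (∀ x → F x ≡ G x) → ∀ xs → List.sum (map F xs) ≡ List.sum (map G xs)
sum-map-cong h []       = refl
sum-map-cong h (x ∷ xs) = cong₂ _+_ (h x) (sum-map-cong h xs)

sum-map-concatMap : ∀ {A B : Set} (F : B → ℕ) (g : A → List B) xs →
                    List.sum (map F (concatMap g xs)) ≡ List.sum (map (λ x → List.sum (map F (g x))) xs)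
sum-map-concatMap F g []       = refl
sum-map-concatMap F g (x ∷ xs) = begin
  List.sum (map F (g x Data.List.++ concatMap g xs))
    ≡⟨ cong List.sum (map-++ F (g x) (concatMap g xs)) ⟩
  List.sum (map F (g x) Data.List.++ map F (concatMap g xs))
    ≡⟨ sum-++ (map F (g x)) _ ⟩
  List.sum (map F (g x)) + List.sum (map F (concatMap g xs))
    ≡⟨ cong (List.sum (map F (g x)) +_) (sum-map-concatMap F g xs) ⟩
  List.sum (map F (g x)) + List.sum (map (λ x → List.sum (map F (g x))) xs) ∎
  where open ≡-Reasoning

sum-tabulate : ∀ {n} (f : Vector ℕ n) → List.sum (tabulate f) ≡ sum f
sum-tabulate {zero}  f = refl
sum-tabulate {suc n} f = cong (f zero +_) (sum-tabulate (λ i → f (suc i)))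

sum-map-∑ : ∀ {A : Set} {m} (F : A → Fin m → ℕ) xs →
            List.sum (map (λ x → ∑[ i < m ] F x i) xs) ≡ ∑[ i < m ] List.sum (map (λ x → F x i) xs)
sum-map-∑ {m = m} F []       = sym (trans (sum-const m 0) (*-zeroʳ m))
sum-map-∑ F (x ∷ xs) = trans (cong (sum (F x) +_) (sum-map-∑ F xs)) (sym (∑-distrib-+ (F x) _))

∑-allFuns : ∀ k m → ((Fin k → Fin m) → ℕ) → ℕ
∑-allFuns k m F = List.sum (map F (allFuns k m))

∑-allFuns-ext : ∀ k m (F : (Fin (suc k) → Fin m) → ℕ) →
                ∑-allFuns (suc k) m F ≡ ∑[ i < m ] ∑-allFuns k m (λ f → F (ext i f))
∑-allFuns-ext k m F = begin
  List.sum (map F (concatMap (λ f → map (λ i → ext i f) (allFin m)) (allFuns k m)))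
    ≡⟨ sum-map-concatMap F _ (allFuns k m) ⟩
  List.sum (map (λ f → List.sum (map F (map (λ i → ext i f) (allFin m)))) (allFuns k m))
    ≡⟨ sum-map-cong row (allFuns k m) ⟩
  List.sum (map (λ f → ∑[ i < m ] F (ext i f)) (allFuns k m))
    ≡⟨ sum-map-∑ (λ f i → F (ext i f)) (allFuns k m) ⟩
  ∑[ i < m ] ∑-allFuns k m (λ f → F (ext i f)) ∎
  where
  open ≡-Reasoning
  row : ∀ f → List.sum (map F (map (λ i → ext i f) (allFin m))) ≡ ∑[ i < m ] F (ext i f)
  row f = trans (cong (List.sum ∘ map F) (map-tabulate (λ i → i) (λ i → ext i f)))
                (trans (cong List.sum (map-tabulate (λ i → ext i f) F)) (sum-tabulate (λ i → F (ext i f))))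

∑-allFuns-∏ : ∀ k m (h : Fin k → Fin m → ℕ) →
              ∑-allFuns k m (λ g → ∏ (λ j → h j (g j))) ≡ ∏ (λ j → ∑[ i < m ] h j i)
∑-allFuns-∏ zero    m h = refl
∑-allFuns-∏ (suc k) m h = begin
  ∑-allFuns (suc k) m (λ g → ∏ (λ j → h j (g j)))
    ≡⟨ ∑-allFuns-ext k m _ ⟩
  ∑[ i < m ] List.sum (map (λ g → h zero i * ∏ (λ j → h (suc j) (g j))) (allFuns k m))
    ≡⟨ sum-cong-≗ (λ i → sum-map-*ˡ (h zero i) (allFuns k m)) ⟩
  ∑[ i < m ] (h zero i * ∑-allFuns k m (λ g → ∏ (λ j → h (suc j) (g j))))
    ≡⟨ sum-cong-≗ (λ i → cong (h zero i *_) (∑-allFuns-∏ k m (λ j → h (suc j)))) ⟩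
  ∑[ i < m ] (h zero i * ∏ (λ j → ∑[ i < m ] h (suc j) i))
    ≡⟨ sym (*-distribʳ-sum _ (h zero)) ⟩
  ∑[ i < m ] h zero i * ∏ (λ j → ∑[ i < m ] h (suc j) i) ∎
  where
  open ≡-Reasoning
  sum-map-*ˡ : ∀ {A : Set} c {F : A → ℕ} xs → List.sum (map (λ x → c * F x) xs) ≡ c * List.sum (map F xs)
  sum-map-*ˡ c []       = sym (*-zeroʳ c)
  sum-map-*ˡ c {F} (x ∷ xs) = trans (cong (c * F x +_) (sum-map-*ˡ c xs)) (sym (*-distribˡ-+ c (F x) _))

indicator-does : ∀ {Q : Set} (d : Dec Q) {X} → X ≤ 1 → (Q → X ≡ 1) → (X ≡ 1 → Q) → indicator (does d) ≡ X
indicator-does (yes q) X≤1 to from = sym (to q)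
indicator-does (no ¬q) z≤n to from = refl
indicator-does (no ¬q) (s≤s z≤n) to from = ⊥-elim (¬q (from refl))

module _ {A : Set} (_≟_ : DecidableEquality A) where

  avoids : A → A → A → ℕ
  avoids x c₁ c₂ = if does (x ≟ c₁) then 0 else if does (x ≟ c₂) then 0 else 1

  avoids-≤1 : ∀ x c₁ c₂ → avoids x c₁ c₂ ≤ 1
  avoids-≤1 x c₁ c₂ with x ≟ c₁
  ... | yes _ = z≤n
  ... | no  _ with x ≟ c₂
  ... | yes _ = z≤n
  ... | no  _ = ≤-refl

  avoids≡1⇔ : ∀ x c₁ c₂ → (avoids x c₁ c₂ ≡ 1 → x ≢ c₁ × x ≢ c₂) × (x ≢ c₁ × x ≢ c₂ → avoids x c₁ c₂ ≡ 1)
  avoids≡1⇔ x c₁ c₂ with x ≟ c₁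
  ... | yes x≡c₁ = (λ ()) , λ (x≢c₁ , _) → ⊥-elim (x≢c₁ x≡c₁)
  ... | no  x≢c₁ with x ≟ c₂
  ... | yes x≡c₂ = (λ ()) , λ (_ , x≢c₂) → ⊥-elim (x≢c₂ x≡c₂)
  ... | no  x≢c₂ = (λ _ → x≢c₁ , x≢c₂) , λ _ → refl

  -- In K 2 b the vertices 0 and 1 form one side and 2 + j the other.
  proper-K₂⇔ : ∀ b (col : Fin (2 + b) → A) →
               (Proper (K 2 b) col → ∀ j → col (suc (suc j)) ≢ col zero × col (suc (suc j)) ≢ col (suc zero))
             × ((∀ j → col (suc (suc j)) ≢ col zero × col (suc (suc j)) ≢ col (suc zero)) → Proper (K 2 b) col)
  proper-K₂⇔ b col = (λ pr j → pr (suc (suc j)) zero tt , pr (suc (suc j)) (suc zero) tt) , from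
    where
    from : (∀ j → col (suc (suc j)) ≢ col zero × col (suc (suc j)) ≢ col (suc zero)) → Proper (K 2 b) col
    from g zero          (suc (suc j)) _ e = proj₁ (g j) (sym e)
    from g (suc zero)    (suc (suc j)) _ e = proj₂ (g j) (sym e)
    from g (suc (suc j)) zero          _ e = proj₁ (g j) e
    from g (suc (suc j)) (suc zero)    _ e = proj₂ (g j) e

  indicator-proper-K₂ : ∀ b (col : Fin (2 + b) → A) →
    indicator (does (proper? (K 2 b) _≟_ col)) ≡ ∏ (λ j → avoids (col (suc (suc j))) (col zero) (col (suc zero)))
  indicator-proper-K₂ b col = indicator-does (proper? (K 2 b) _≟_ col)
    (∏-≤1 _ (λ j → avoids-≤1 (col (suc (suc j))) (col zero) (col (suc zero))))
    (λ pr → ⇒∏≡1 _ (λ j → proj₂ (avoids≡1⇔ _ _ _) (proj₁ (proper-K₂⇔ b col) pr j)))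
    (λ ∏≡1 → proj₂ (proper-K₂⇔ b col) (λ j → proj₁ (avoids≡1⇔ _ _ _) (∏≡1⇒ _ ∏≡1 j)))

  -- Choosing the colours of 0 and 1 first, the 2 + j then have independent choices.
  count-proper-K₂ : ∀ b m (L : Fin (2 + b) → Fin m → A) →
    length (filter (λ c → proper? (K 2 b) _≟_ (λ v → L v (c v))) (allFuns (2 + b) m))
    ≡ ∑[ i₁ < m ] ∑[ i₂ < m ] ∏ (λ j → ∑[ k < m ] avoids (L (suc (suc j)) k) (L zero i₁) (L (suc zero) i₂))
  count-proper-K₂ b m L = begin
    length (filter (λ c → proper? (K 2 b) _≟_ (λ v → L v (c v))) (allFuns (2 + b) m))
      ≡⟨ length-filter≡∑indicator (λ c → proper? (K 2 b) _≟_ (λ v → L v (c v))) (allFuns (2 + b) m) ⟩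
    ∑-allFuns (2 + b) m (λ c → indicator (does (proper? (K 2 b) _≟_ (λ v → L v (c v)))))
      ≡⟨ ∑-allFuns-ext (suc b) m (λ c → indicator (does (proper? (K 2 b) _≟_ (λ v → L v (c v))))) ⟩
    ∑[ i₁ < m ] ∑-allFuns (suc b) m (λ f → indicator (does (proper? (K 2 b) _≟_ (λ v → L v (ext i₁ f v)))))
      ≡⟨ sum-cong-≗ (λ i₁ → ∑-allFuns-ext b m (λ f → indicator (does (proper? (K 2 b) _≟_ (λ v → L v (ext i₁ f v)))))) ⟩
    ∑[ i₁ < m ] ∑[ i₂ < m ] ∑-allFuns b m (λ g → indicator (does (proper? (K 2 b) _≟_ (λ v → L v (ext i₁ (ext i₂ g) v)))))
      ≡⟨ sum-cong-≗ (λ i₁ → sum-cong-≗ (λ i₂ → sum-map-cong (λ g → indicator-proper-K₂ b (λ v → L v (ext i₁ (ext i₂ g) v))) (allFuns b m))) ⟩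
    ∑[ i₁ < m ] ∑[ i₂ < m ] ∑-allFuns b m (λ g → ∏ (λ j → avoids (L (suc (suc j)) (g j)) (L zero i₁) (L (suc zero) i₂)))
      ≡⟨ sum-cong-≗ (λ i₁ → sum-cong-≗ (λ i₂ → ∑-allFuns-∏ b m (λ j k → avoids (L (suc (suc j)) k) (L zero i₁) (L (suc zero) i₂)))) ⟩
    ∑[ i₁ < m ] ∑[ i₂ < m ] ∏ (λ j → ∑[ k < m ] avoids (L (suc (suc j)) k) (L zero i₁) (L (suc zero) i₂)) ∎
    where open ≡-Reasoning

  δ : A → A → ℕ
  δ x y = indicator (does (x ≟ y))

  δ-≤1 : ∀ x y → δ x y ≤ 1
  δ-≤1 x y with x ≟ y
  ... | yes _ = ≤-refl
  ... | no  _ = z≤n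

  δ-sym : ∀ x y → δ x y ≡ δ y x
  δ-sym x y with x ≟ y | y ≟ x
  ... | yes _   | yes _   = refl
  ... | no  _   | no  _   = refl
  ... | yes x≡y | no  y≢x = ⊥-elim (y≢x (sym x≡y))
  ... | no  x≢y | yes y≡x = ⊥-elim (x≢y (sym y≡x))

  δ-refl : ∀ x → δ x x ≡ 1
  δ-refl x with x ≟ x
  ... | yes _   = refl
  ... | no  x≢x = ⊥-elim (x≢x refl)

  δ-≢ : ∀ {x y} → x ≢ y → δ x y ≡ 0
  δ-≢ {x} {y} x≢y with x ≟ y
  ... | yes x≡y = ⊥-elim (x≢y x≡y)
  ... | no  _   = refl

  δ≡1⇒≡ : ∀ {x y} → δ x y ≡ 1 → x ≡ y
  δ≡1⇒≡ {x} {y} h with x ≟ y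
  ... | yes x≡y = x≡y

  -- Inclusion–exclusion for a single colour x against the pair {c₁, c₂}.
  avoids+δ+δ : ∀ x c₁ c₂ → avoids x c₁ c₂ + δ x c₁ + δ x c₂ ≡ 1 + δ c₁ c₂ * δ x c₁
  avoids+δ+δ x c₁ c₂ with x ≟ c₁ | x ≟ c₂ | c₁ ≟ c₂
  ... | yes _   | yes _   | yes _   = refl
  ... | yes x≡1 | yes x≡2 | no  1≢2 = ⊥-elim (1≢2 (trans (sym x≡1) x≡2))
  ... | yes x≡1 | no  x≢2 | yes 1≡2 = ⊥-elim (x≢2 (trans x≡1 1≡2))
  ... | yes _   | no  _   | no  _   = refl
  ... | no  x≢1 | yes x≡2 | yes 1≡2 = ⊥-elim (x≢1 (trans x≡2 (sym 1≡2)))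
  ... | no  _   | yes _   | no  _   = refl
  ... | no  _   | no  _   | yes _   = refl
  ... | no  _   | no  _   | no  _   = refl

  δ*δ : ∀ x c₁ c₂ → δ x c₁ * δ x c₂ ≡ δ c₁ c₂ * δ x c₁
  δ*δ x c₁ c₂ with x ≟ c₁ | x ≟ c₂ | c₁ ≟ c₂
  ... | yes _   | yes _   | yes _   = refl
  ... | yes x≡1 | yes x≡2 | no  1≢2 = ⊥-elim (1≢2 (trans (sym x≡1) x≡2))
  ... | yes x≡1 | no  x≢2 | yes 1≡2 = ⊥-elim (x≢2 (trans x≡1 1≡2))
  ... | yes _   | no  _   | no  _   = refl
  ... | no  _   | yes _   | yes _   = refl
  ... | no  _   | yes _   | no  _   = refl
  ... | no  _   | no  _   | yes _   = refl
  ... | no  _   | no  _   | no  _   = refl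

  occurrences : ∀ {n} → (Fin n → A) → A → ℕ
  occurrences ℓ c = ∑[ k < _ ] δ (ℓ k) c

  occurrences-≤1 : ∀ {n} (ℓ : Fin n → A) → Injective _≡_ _≡_ ℓ → ∀ c → occurrences ℓ c ≤ 1
  occurrences-≤1 {zero}  ℓ inj c = z≤n
  occurrences-≤1 {suc n} ℓ inj c with ℓ zero ≟ c
  ... | yes ℓ₀≡c = s≤s (≤-reflexive (trans (sum-cong-≗ {n} (λ k → δ-≢ (λ ℓₖ≡c → 0≢suc (inj (trans ℓ₀≡c (sym ℓₖ≡c))))))
                                             (trans (sum-const n 0) (*-zeroʳ n))))
    where
    0≢suc : ∀ {k : Fin n} → zero ≢ suc k
    0≢suc ()
  ... | no  _    = occurrences-≤1 (λ k → ℓ (suc k)) (λ e → Fin.suc-injective (inj e)) c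

  occurrences-self : ∀ {n} (ℓ : Fin n → A) → Injective _≡_ _≡_ ℓ → ∀ i → occurrences ℓ (ℓ i) ≡ 1
  occurrences-self ℓ inj i = ≤-antisym (occurrences-≤1 ℓ inj (ℓ i))
                                       (subst (_≤ occurrences ℓ (ℓ i)) (δ-refl (ℓ i)) (term≤sum (λ k → δ (ℓ k) (ℓ i)) i))

  -- Lists of size m on the vertices 0, 1 and 2 + j of K 2 b. By count-proper-K₂, N counts the
  -- L-colourings, free j c₁ c₂ being |Lⱼ ∖ {c₁, c₂}|.
  module ListsOnK₂ (m b : ℕ) (L₁ L₂ : Fin m → A) (Lⱼ : Fin b → Fin m → A)
                   (L₁-inj : Injective _≡_ _≡_ L₁) (L₂-inj : Injective _≡_ _≡_ L₂)
                   (Lⱼ-inj : ∀ j → Injective _≡_ _≡_ (Lⱼ j)) where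

    inL : Fin b → A → ℕ
    inL j = occurrences (Lⱼ j)

    inL-≤1 : ∀ j c → inL j c ≤ 1
    inL-≤1 j = occurrences-≤1 (Lⱼ j) (Lⱼ-inj j)

    free : Fin b → A → A → ℕ
    free j c₁ c₂ = ∑[ k < m ] avoids (Lⱼ j k) c₁ c₂

    weight : Fin m → Fin m → ℕ
    weight i₁ i₂ = ∏ (λ j → free j (L₁ i₁) (L₂ i₂))

    N : ℕ
    N = ∑∑ weight

    same differ : Fin m → Fin m → ℕ
    same i₁ i₂ = δ (L₁ i₁) (L₂ i₂)
    differ i₁ i₂ = 1 ∸ same i₁ i₂

    common distinct : ℕ
    common = ∑∑ same
    distinct = ∑∑ differ

    free+inL+inL : ∀ j c₁ c₂ → free j c₁ c₂ + inL j c₁ + inL j c₂ ≡ m + δ c₁ c₂ * inL j c₁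
    free+inL+inL j c₁ c₂ = begin
      free j c₁ c₂ + inL j c₁ + inL j c₂
        ≡⟨ cong (_+ inL j c₂) (sym (∑-distrib-+ (λ k → avoids (Lⱼ j k) c₁ c₂) (λ k → δ (Lⱼ j k) c₁))) ⟩
      ∑[ k < m ] (avoids (Lⱼ j k) c₁ c₂ + δ (Lⱼ j k) c₁) + inL j c₂
        ≡⟨ sym (∑-distrib-+ (λ k → avoids (Lⱼ j k) c₁ c₂ + δ (Lⱼ j k) c₁) (λ k → δ (Lⱼ j k) c₂)) ⟩
      ∑[ k < m ] (avoids (Lⱼ j k) c₁ c₂ + δ (Lⱼ j k) c₁ + δ (Lⱼ j k) c₂)
        ≡⟨ sum-cong-≗ {m} (λ k → avoids+δ+δ (Lⱼ j k) c₁ c₂) ⟩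
      ∑[ k < m ] (1 + δ c₁ c₂ * δ (Lⱼ j k) c₁)
        ≡⟨ ∑-distrib-+ (λ _ → 1) (λ k → δ c₁ c₂ * δ (Lⱼ j k) c₁) ⟩
      ∑[ k < m ] 1 + ∑[ k < m ] (δ c₁ c₂ * δ (Lⱼ j k) c₁)
        ≡⟨ cong₂ _+_ (trans (sum-const m 1) (*-identityʳ m)) (sym (*-distribˡ-sum (δ c₁ c₂) (λ k → δ (Lⱼ j k) c₁))) ⟩
      m + δ c₁ c₂ * inL j c₁ ∎
      where open ≡-Reasoning

    free-same+inL : ∀ j c → free j c c + inL j c ≡ m
    free-same+inL j c = +-cancelʳ-≡ (inL j c) _ _
      (trans (trans (free+inL+inL j c c) (cong (λ x → m + x * inL j c) (δ-refl c))) (cong (m +_) (*-identityˡ _)))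

    same-≤1 : ∀ i₁ i₂ → same i₁ i₂ ≤ 1
    same-≤1 i₁ i₂ = δ-≤1 (L₁ i₁) (L₂ i₂)

    same+differ≡1 : ∀ i₁ i₂ → same i₁ i₂ + differ i₁ i₂ ≡ 1
    same+differ≡1 i₁ i₂ = m+[n∸m]≡n (same-≤1 i₁ i₂)

    split : ∀ (f : Fin m → Fin m → ℕ) → ∑∑ f ≡ ∑∑ (λ i₁ i₂ → same i₁ i₂ * f i₁ i₂) + ∑∑ (λ i₁ i₂ → differ i₁ i₂ * f i₁ i₂)
    split f = trans (∑∑-cong λ i₁ i₂ → begin
                       f i₁ i₂                                   ≡⟨ sym (*-identityˡ (f i₁ i₂)) ⟩
                       1 * f i₁ i₂                               ≡⟨ cong (_* f i₁ i₂) (sym (same+differ≡1 i₁ i₂)) ⟩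
                       (same i₁ i₂ + differ i₁ i₂) * f i₁ i₂      ≡⟨ *-distribʳ-+ (f i₁ i₂) (same i₁ i₂) (differ i₁ i₂) ⟩
                       same i₁ i₂ * f i₁ i₂ + differ i₁ i₂ * f i₁ i₂ ∎)
                    (∑∑-distrib-+ (λ i₁ i₂ → same i₁ i₂ * f i₁ i₂) (λ i₁ i₂ → differ i₁ i₂ * f i₁ i₂))
      where open ≡-Reasoning

    distinct+common≡m² : distinct + common ≡ m * m
    distinct+common≡m² = begin
      distinct + common              ≡⟨ +-comm distinct common ⟩
      common + distinct              ≡⟨ sym (∑∑-distrib-+ same differ) ⟩
      ∑∑ (λ i₁ i₂ → same i₁ i₂ + differ i₁ i₂) ≡⟨ ∑∑-cong same+differ≡1 ⟩
      ∑∑ {m} (λ _ _ → 1)             ≡⟨ trans (∑∑-const m 1) (cong (m *_) (*-identityʳ m)) ⟩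
      m * m                          ∎
      where open ≡-Reasoning

    common≤m : common ≤ m
    common≤m = begin
      common                               ≡⟨ ∑∑-cong (λ i₁ i₂ → δ-sym (L₁ i₁) (L₂ i₂)) ⟩
      ∑[ i₁ < m ] occurrences L₂ (L₁ i₁)   ≤⟨ sum-mono-≤ {m} (λ i₁ → occurrences-≤1 L₂ L₂-inj (L₁ i₁)) ⟩
      ∑[ i₁ < m ] 1                        ≡⟨ trans (sum-const m 1) (*-identityʳ m) ⟩
      m                                    ∎
      where open ≤-Reasoning

    shared₁ shared₂ sharedAll : Fin b → ℕ
    shared₁ j = ∑[ i₁ < m ] inL j (L₁ i₁)
    shared₂ j = ∑[ i₂ < m ] inL j (L₂ i₂)
    sharedAll j = ∑∑ (λ i₁ i₂ → same i₁ i₂ * inL j (L₁ i₁))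

    sharedAll≤common : ∀ j → sharedAll j ≤ common
    sharedAll≤common j = ∑∑-mono-≤ (λ i₁ i₂ → x*y≤x (same i₁ i₂) (inL j (L₁ i₁)) (inL-≤1 j (L₁ i₁)))

    bothIn : Fin m → Fin m → ℕ
    bothIn i₁ i₂ = ∑[ j < b ] (inL j (L₁ i₁) * inL j (L₂ i₂))

    ∑inL≡∑occurrences : ∀ (L : Fin m → A) j → ∑[ i < m ] inL j (L i) ≡ ∑[ k < m ] occurrences L (Lⱼ j k)
    ∑inL≡∑occurrences L j = trans (∑-comm (λ i k → δ (Lⱼ j k) (L i)))
                                  (sum-cong-≗ {m} (λ k → sum-cong-≗ {m} (λ i → δ-sym (Lⱼ j k) (L i))))

    sharedAll≡∑occurrences² : ∀ j → sharedAll j ≡ ∑[ k < m ] (occurrences L₁ (Lⱼ j k) * occurrences L₂ (Lⱼ j k))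
    sharedAll≡∑occurrences² j = sym (begin
      ∑[ k < m ] (occurrences L₁ (x k) * occurrences L₂ (x k))
        ≡⟨ sum-cong-≗ {m} (λ k → *-distribʳ-sum (occurrences L₂ (x k)) (λ i₁ → δ (L₁ i₁) (x k))) ⟩
      ∑[ k < m ] ∑[ i₁ < m ] (δ (L₁ i₁) (x k) * occurrences L₂ (x k))
        ≡⟨ sum-cong-≗ {m} (λ k → sum-cong-≗ {m} (λ i₁ → *-distribˡ-sum (δ (L₁ i₁) (x k)) (λ i₂ → δ (L₂ i₂) (x k)))) ⟩
      ∑[ k < m ] ∑[ i₁ < m ] ∑[ i₂ < m ] (δ (L₁ i₁) (x k) * δ (L₂ i₂) (x k))
        ≡⟨ ∑-comm (λ k i₁ → ∑[ i₂ < m ] (δ (L₁ i₁) (x k) * δ (L₂ i₂) (x k))) ⟩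
      ∑[ i₁ < m ] ∑[ k < m ] ∑[ i₂ < m ] (δ (L₁ i₁) (x k) * δ (L₂ i₂) (x k))
        ≡⟨ sum-cong-≗ {m} (λ i₁ → ∑-comm (λ k i₂ → δ (L₁ i₁) (x k) * δ (L₂ i₂) (x k))) ⟩
      ∑∑ (λ i₁ i₂ → ∑[ k < m ] (δ (L₁ i₁) (x k) * δ (L₂ i₂) (x k)))
        ≡⟨ ∑∑-cong (λ i₁ i₂ → sum-cong-≗ {m} (λ k → cong₂ _*_ (δ-sym (L₁ i₁) (x k)) (δ-sym (L₂ i₂) (x k)))) ⟩
      ∑∑ (λ i₁ i₂ → ∑[ k < m ] (δ (x k) (L₁ i₁) * δ (x k) (L₂ i₂)))
        ≡⟨ ∑∑-cong (λ i₁ i₂ → sum-cong-≗ {m} (λ k → δ*δ (x k) (L₁ i₁) (L₂ i₂))) ⟩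
      ∑∑ (λ i₁ i₂ → ∑[ k < m ] (same i₁ i₂ * δ (x k) (L₁ i₁)))
        ≡⟨ ∑∑-cong (λ i₁ i₂ → sym (*-distribˡ-sum (same i₁ i₂) (λ k → δ (x k) (L₁ i₁)))) ⟩
      sharedAll j ∎)
      where
      open ≡-Reasoning
      x = Lⱼ j

    shared₁+shared₂≤ : ∀ j → shared₁ j + shared₂ j ≤ m + sharedAll j
    shared₁+shared₂≤ j = begin
      shared₁ j + shared₂ j
        ≡⟨ cong₂ _+_ (∑inL≡∑occurrences L₁ j) (∑inL≡∑occurrences L₂ j) ⟩
      ∑[ k < m ] occurrences L₁ (Lⱼ j k) + ∑[ k < m ] occurrences L₂ (Lⱼ j k)
        ≡⟨ sym (∑-distrib-+ (λ k → occurrences L₁ (Lⱼ j k)) (λ k → occurrences L₂ (Lⱼ j k))) ⟩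
      ∑[ k < m ] (occurrences L₁ (Lⱼ j k) + occurrences L₂ (Lⱼ j k))
        ≤⟨ sum-mono-≤ {m} (λ k → x+y≤1+x*y _ _ (occurrences-≤1 L₁ L₁-inj (Lⱼ j k)) (occurrences-≤1 L₂ L₂-inj (Lⱼ j k))) ⟩
      ∑[ k < m ] (1 + occurrences L₁ (Lⱼ j k) * occurrences L₂ (Lⱼ j k))
        ≡⟨ ∑-distrib-+ (λ _ → 1) (λ k → occurrences L₁ (Lⱼ j k) * occurrences L₂ (Lⱼ j k)) ⟩
      ∑[ k < m ] 1 + ∑[ k < m ] (occurrences L₁ (Lⱼ j k) * occurrences L₂ (Lⱼ j k))
        ≡⟨ cong₂ _+_ (trans (sum-const m 1) (*-identityʳ m)) (sym (sharedAll≡∑occurrences² j)) ⟩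
      m + sharedAll j ∎
      where open ≤-Reasoning

    ∑free : ∀ j → ∑∑ (λ i₁ i₂ → free j (L₁ i₁) (L₂ i₂)) + m * shared₁ j + m * shared₂ j ≡ m * m * m + sharedAll j
    ∑free j = begin
      ∑∑ F + m * shared₁ j + m * shared₂ j
        ≡⟨ cong₂ (λ x y → ∑∑ F + x + y)
             (trans (*-distribˡ-sum m (λ i₁ → inL j (L₁ i₁))) (sum-cong-≗ {m} (λ i₁ → sym (sum-const m (inL j (L₁ i₁))))))
             (sym (sum-const m (shared₂ j))) ⟩
      ∑∑ F + ∑∑ (λ i₁ i₂ → inL j (L₁ i₁)) + ∑∑ (λ i₁ i₂ → inL j (L₂ i₂))
        ≡⟨ sym (trans (∑∑-distrib-+ (λ i₁ i₂ → F i₁ i₂ + inL j (L₁ i₁)) (λ i₁ i₂ → inL j (L₂ i₂)))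
                      (cong (_+ ∑∑ (λ i₁ i₂ → inL j (L₂ i₂))) (∑∑-distrib-+ F (λ i₁ i₂ → inL j (L₁ i₁))))) ⟩
      ∑∑ (λ i₁ i₂ → F i₁ i₂ + inL j (L₁ i₁) + inL j (L₂ i₂))
        ≡⟨ ∑∑-cong (λ i₁ i₂ → free+inL+inL j (L₁ i₁) (L₂ i₂)) ⟩
      ∑∑ (λ i₁ i₂ → m + same i₁ i₂ * inL j (L₁ i₁))
        ≡⟨ ∑∑-distrib-+ (λ _ _ → m) (λ i₁ i₂ → same i₁ i₂ * inL j (L₁ i₁)) ⟩
      ∑∑ {m} (λ _ _ → m) + sharedAll j
        ≡⟨ cong (_+ sharedAll j) (trans (∑∑-const m m) (sym (*-assoc m m m))) ⟩
      m * m * m + sharedAll j ∎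
      where
      open ≡-Reasoning
      F = λ i₁ i₂ → free j (L₁ i₁) (L₂ i₂)

    ∑same*free : ∀ j → ∑∑ (λ i₁ i₂ → same i₁ i₂ * free j (L₁ i₁) (L₂ i₂)) + sharedAll j ≡ m * common
    ∑same*free j = begin
      ∑∑ (λ i₁ i₂ → same i₁ i₂ * free j (L₁ i₁) (L₂ i₂)) + sharedAll j
        ≡⟨ sym (∑∑-distrib-+ (λ i₁ i₂ → same i₁ i₂ * free j (L₁ i₁) (L₂ i₂)) (λ i₁ i₂ → same i₁ i₂ * inL j (L₁ i₁))) ⟩
      ∑∑ (λ i₁ i₂ → same i₁ i₂ * free j (L₁ i₁) (L₂ i₂) + same i₁ i₂ * inL j (L₁ i₁))
        ≡⟨ ∑∑-cong cell ⟩
      ∑∑ (λ i₁ i₂ → same i₁ i₂ * m)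
        ≡⟨ trans (∑∑-*ʳ m same) (*-comm common m) ⟩
      m * common ∎
      where
      open ≡-Reasoning
      cell : ∀ i₁ i₂ → same i₁ i₂ * free j (L₁ i₁) (L₂ i₂) + same i₁ i₂ * inL j (L₁ i₁) ≡ same i₁ i₂ * m
      cell i₁ i₂ with L₁ i₁ ≟ L₂ i₂
      ... | no  _       = refl
      ... | yes L₁≡L₂ = begin
        1 * free j (L₁ i₁) (L₂ i₂) + 1 * inL j (L₁ i₁) ≡⟨ cong₂ _+_ (*-identityˡ (free j (L₁ i₁) (L₂ i₂))) (*-identityˡ (inL j (L₁ i₁))) ⟩
        free j (L₁ i₁) (L₂ i₂) + inL j (L₁ i₁)         ≡⟨ cong (λ c → free j (L₁ i₁) c + inL j (L₁ i₁)) (sym L₁≡L₂) ⟩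
        free j (L₁ i₁) (L₁ i₁) + inL j (L₁ i₁)         ≡⟨ free-same+inL j (L₁ i₁) ⟩
        m                                             ≡⟨ sym (*-identityˡ m) ⟩
        1 * m                                         ∎

    -- m stays a variable, with m ≡ 2 + r, so that sums over Fin m do not unfold during unification.
    module _ (r : ℕ) (m≡2+r : m ≡ 2 + r) where

      r≤free : ∀ j c₁ c₂ → r ≤ free j c₁ c₂
      r≤free j c₁ c₂ = +-cancelʳ-≤ 2 r (free j c₁ c₂) (begin
        r + 2                                 ≡⟨ trans (+-comm r 2) (sym m≡2+r) ⟩
        m                                     ≤⟨ m≤m+n m _ ⟩
        m + δ c₁ c₂ * inL j c₁                ≡⟨ sym (free+inL+inL j c₁ c₂) ⟩
        free j c₁ c₂ + inL j c₁ + inL j c₂    ≤⟨ +-mono-≤ (+-monoʳ-≤ (free j c₁ c₂) (inL-≤1 j c₁)) (inL-≤1 j c₂) ⟩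
        free j c₁ c₂ + 1 + 1                  ≡⟨ +-assoc (free j c₁ c₂) 1 1 ⟩
        free j c₁ c₂ + 2                      ∎)
        where open ≤-Reasoning

      1+r≤free-same : ∀ j c → suc r ≤ free j c c
      1+r≤free-same j c = +-cancelʳ-≤ 1 (suc r) (free j c c) (begin
        suc r + 1           ≡⟨ trans (+-comm (suc r) 1) (sym m≡2+r) ⟩
        m                   ≡⟨ sym (free-same+inL j c) ⟩
        free j c c + inL j c ≤⟨ +-monoʳ-≤ (free j c c) (inL-≤1 j c) ⟩
        free j c c + 1      ∎)
        where open ≤-Reasoning

      weight-lower : ∀ i₁ i₂ → same i₁ i₂ * suc r ^ b + differ i₁ i₂ * r ^ b ≤ weight i₁ i₂
      weight-lower i₁ i₂ with L₁ i₁ ≟ L₂ i₂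
      ... | yes L₁≡L₂ = begin
        1 * suc r ^ b + 0 * r ^ b  ≡⟨ trans (+-identityʳ _) (*-identityˡ _) ⟩
        suc r ^ b                  ≡⟨ sym (∏-const b (suc r)) ⟩
        ∏ {b} (λ _ → suc r)        ≤⟨ ∏-mono-≤ (λ j → subst (λ c → suc r ≤ free j (L₁ i₁) c) L₁≡L₂ (1+r≤free-same j (L₁ i₁))) ⟩
        weight i₁ i₂               ∎
        where open ≤-Reasoning
      ... | no  _ = begin
        0 * suc r ^ b + 1 * r ^ b  ≡⟨ *-identityˡ _ ⟩
        r ^ b                      ≡⟨ sym (∏-const b r) ⟩
        ∏ {b} (λ _ → r)            ≤⟨ ∏-mono-≤ (λ j → r≤free j (L₁ i₁) (L₂ i₂)) ⟩
        weight i₁ i₂               ∎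
        where open ≤-Reasoning

      N-lower : common * suc r ^ b + distinct * r ^ b ≤ N
      N-lower = begin
        common * suc r ^ b + distinct * r ^ b
          ≡⟨ sym (cong₂ _+_ (∑∑-*ʳ (suc r ^ b) same) (∑∑-*ʳ (r ^ b) differ)) ⟩
        ∑∑ (λ i₁ i₂ → same i₁ i₂ * suc r ^ b) + ∑∑ (λ i₁ i₂ → differ i₁ i₂ * r ^ b)
          ≡⟨ sym (∑∑-distrib-+ (λ i₁ i₂ → same i₁ i₂ * suc r ^ b) (λ i₁ i₂ → differ i₁ i₂ * r ^ b)) ⟩
        ∑∑ (λ i₁ i₂ → same i₁ i₂ * suc r ^ b + differ i₁ i₂ * r ^ b)
          ≤⟨ ∑∑-mono-≤ weight-lower ⟩
        N ∎
        where open ≤-Reasoning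

      module _ (L₁⊆Lⱼ : ∀ j i → inL j (L₁ i) ≡ 1) (L₂⊆Lⱼ : ∀ j i → inL j (L₂ i) ≡ 1) where

        weight-covered : ∀ i₁ i₂ → weight i₁ i₂ ≡ same i₁ i₂ * suc r ^ b + differ i₁ i₂ * r ^ b
        weight-covered i₁ i₂ with L₁ i₁ ≟ L₂ i₂
        ... | yes L₁≡L₂ = begin
          weight i₁ i₂           ≡⟨ ∏-cong (λ j → +-cancelʳ-≡ 1 _ _ (free-same j)) ⟩
          ∏ {b} (λ _ → suc r)    ≡⟨ ∏-const b (suc r) ⟩
          suc r ^ b              ≡⟨ sym (trans (+-identityʳ _) (*-identityˡ _)) ⟩
          1 * suc r ^ b + 0 * r ^ b ∎
          where
          open ≡-Reasoning
          free-same : ∀ j → free j (L₁ i₁) (L₂ i₂) + 1 ≡ suc r + 1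
          free-same j = begin
            free j (L₁ i₁) (L₂ i₂) + 1           ≡⟨ cong₂ (λ c x → free j (L₁ i₁) c + x) (sym L₁≡L₂) (sym (L₁⊆Lⱼ j i₁)) ⟩
            free j (L₁ i₁) (L₁ i₁) + inL j (L₁ i₁) ≡⟨ free-same+inL j (L₁ i₁) ⟩
            m                                    ≡⟨ trans m≡2+r (+-comm 1 (suc r)) ⟩
            suc r + 1                            ∎
        ... | no  L₁≢L₂ = begin
          weight i₁ i₂           ≡⟨ ∏-cong (λ j → +-cancelʳ-≡ 2 _ _ (free-distinct j)) ⟩
          ∏ {b} (λ _ → r)        ≡⟨ ∏-const b r ⟩
          r ^ b                  ≡⟨ sym (*-identityˡ _) ⟩
          0 * suc r ^ b + 1 * r ^ b ∎
          where
          open ≡-Reasoning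
          free-distinct : ∀ j → free j (L₁ i₁) (L₂ i₂) + 2 ≡ r + 2
          free-distinct j = begin
            free j (L₁ i₁) (L₂ i₂) + 2
              ≡⟨ sym (+-assoc (free j (L₁ i₁) (L₂ i₂)) 1 1) ⟩
            free j (L₁ i₁) (L₂ i₂) + 1 + 1
              ≡⟨ cong₂ (λ x y → free j (L₁ i₁) (L₂ i₂) + x + y) (sym (L₁⊆Lⱼ j i₁)) (sym (L₂⊆Lⱼ j i₂)) ⟩
            free j (L₁ i₁) (L₂ i₂) + inL j (L₁ i₁) + inL j (L₂ i₂)
              ≡⟨ free+inL+inL j (L₁ i₁) (L₂ i₂) ⟩
            m + δ (L₁ i₁) (L₂ i₂) * inL j (L₁ i₁)
              ≡⟨ cong (λ x → m + x * inL j (L₁ i₁)) (δ-≢ L₁≢L₂) ⟩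
            m + 0
              ≡⟨ trans (+-identityʳ m) (trans m≡2+r (+-comm 2 r)) ⟩
            r + 2 ∎

        N-covered : N ≡ common * suc r ^ b + distinct * r ^ b
        N-covered = begin
          N ≡⟨ ∑∑-cong weight-covered ⟩
          ∑∑ (λ i₁ i₂ → same i₁ i₂ * suc r ^ b + differ i₁ i₂ * r ^ b)
            ≡⟨ ∑∑-distrib-+ (λ i₁ i₂ → same i₁ i₂ * suc r ^ b) (λ i₁ i₂ → differ i₁ i₂ * r ^ b) ⟩
          ∑∑ (λ i₁ i₂ → same i₁ i₂ * suc r ^ b) + ∑∑ (λ i₁ i₂ → differ i₁ i₂ * r ^ b)
            ≡⟨ cong₂ _+_ (∑∑-*ʳ (suc r ^ b) same) (∑∑-*ʳ (r ^ b) differ) ⟩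
          common * suc r ^ b + distinct * r ^ b ∎
          where open ≡-Reasoning

      distinct≡ : common ≡ m → distinct ≡ (2 + r) * (1 + r)
      distinct≡ common≡m = +-cancelʳ-≡ (2 + r) _ _ (begin
        distinct + (2 + r)        ≡⟨ cong (distinct +_) (sym (trans common≡m m≡2+r)) ⟩
        distinct + common         ≡⟨ distinct+common≡m² ⟩
        m * m                     ≡⟨ cong (λ x → x * x) m≡2+r ⟩
        (2 + r) * (2 + r)         ≡⟨ sym (m[m-1]+m≡m² r) ⟩
        (2 + r) * (1 + r) + (2 + r) ∎)
        where open ≡-Reasoning

      P-K₂≤N-all-common : common ≡ m → P-K₂ b r ≤ N
      P-K₂≤N-all-common common≡m =
        subst₂ (λ t Q → t * suc r ^ b + Q * r ^ b ≤ N) (trans common≡m m≡2+r) (distinct≡ common≡m) N-lower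

      excess : Fin b → Fin m → Fin m → ℕ
      excess j i₁ i₂ = free j (L₁ i₁) (L₂ i₂) ∸ r

      free≡r+excess : ∀ j i₁ i₂ → free j (L₁ i₁) (L₂ i₂) ≡ r + excess j i₁ i₂
      free≡r+excess j i₁ i₂ = sym (m+[n∸m]≡n (r≤free j (L₁ i₁) (L₂ i₂)))

      weight-linear : ∀ i₁ i₂ → same i₁ i₂ * (r * suc r ^ b) + differ i₁ i₂ * (r * r ^ b + r ^ b * ∑[ j < b ] excess j i₁ i₂)
                                ≤ r * weight i₁ i₂
      weight-linear i₁ i₂ with L₁ i₁ ≟ L₂ i₂
      ... | yes L₁≡L₂ = begin
        1 * (r * suc r ^ b) + 0    ≡⟨ trans (+-identityʳ _) (*-identityˡ _) ⟩
        r * suc r ^ b              ≡⟨ cong (r *_) (sym (∏-const b (suc r))) ⟩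
        r * ∏ {b} (λ _ → suc r)    ≤⟨ *-monoʳ-≤ r (∏-mono-≤ (λ j → subst (λ c → suc r ≤ free j (L₁ i₁) c) L₁≡L₂ (1+r≤free-same j (L₁ i₁)))) ⟩
        r * weight i₁ i₂           ∎
        where open ≤-Reasoning
      ... | no  _ = begin
        0 * (r * suc r ^ b) + 1 * (r * r ^ b + r ^ b * ∑[ j < b ] excess j i₁ i₂) ≡⟨ *-identityˡ _ ⟩
        r * r ^ b + r ^ b * ∑[ j < b ] excess j i₁ i₂ ≤⟨ bernoulli r b (λ j → excess j i₁ i₂) ⟩
        r * ∏ (λ j → r + excess j i₁ i₂)             ≡⟨ cong (r *_) (∏-cong (λ j → sym (free≡r+excess j i₁ i₂))) ⟩
        r * weight i₁ i₂                             ∎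
        where open ≤-Reasoning

      excessOfDistinct : ℕ
      excessOfDistinct = ∑∑ (λ i₁ i₂ → differ i₁ i₂ * ∑[ j < b ] excess j i₁ i₂)

      N-linear : common * (r * suc r ^ b) + distinct * (r * r ^ b) + r ^ b * excessOfDistinct ≤ r * N
      N-linear = begin
        common * (r * suc r ^ b) + distinct * (r * r ^ b) + r ^ b * excessOfDistinct
          ≡⟨ cong₂ (λ x y → x + y + r ^ b * excessOfDistinct) (sym (∑∑-*ʳ (r * suc r ^ b) same)) (sym (∑∑-*ʳ (r * r ^ b) differ)) ⟩
        ∑∑ S + ∑∑ (λ i₁ i₂ → differ i₁ i₂ * (r * r ^ b)) + r ^ b * excessOfDistinct
          ≡⟨ +-assoc (∑∑ S) _ _ ⟩
        ∑∑ S + (∑∑ (λ i₁ i₂ → differ i₁ i₂ * (r * r ^ b)) + r ^ b * excessOfDistinct)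
          ≡⟨ cong (λ x → ∑∑ S + (∑∑ (λ i₁ i₂ → differ i₁ i₂ * (r * r ^ b)) + x))
                  (sym (∑∑-*ˡ (r ^ b) (λ i₁ i₂ → differ i₁ i₂ * ∑[ j < b ] excess j i₁ i₂))) ⟩
        ∑∑ S + (∑∑ (λ i₁ i₂ → differ i₁ i₂ * (r * r ^ b)) + ∑∑ (λ i₁ i₂ → r ^ b * (differ i₁ i₂ * E i₁ i₂)))
          ≡⟨ cong (∑∑ S +_) (sym (∑∑-distrib-+ (λ i₁ i₂ → differ i₁ i₂ * (r * r ^ b)) (λ i₁ i₂ → r ^ b * (differ i₁ i₂ * E i₁ i₂)))) ⟩
        ∑∑ S + ∑∑ (λ i₁ i₂ → differ i₁ i₂ * (r * r ^ b) + r ^ b * (differ i₁ i₂ * E i₁ i₂))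
          ≡⟨ cong (∑∑ S +_) (∑∑-cong (λ i₁ i₂ → factor (differ i₁ i₂) (r * r ^ b) (r ^ b) (E i₁ i₂))) ⟩
        ∑∑ S + ∑∑ (λ i₁ i₂ → differ i₁ i₂ * (r * r ^ b + r ^ b * E i₁ i₂))
          ≡⟨ sym (∑∑-distrib-+ S (λ i₁ i₂ → differ i₁ i₂ * (r * r ^ b + r ^ b * E i₁ i₂))) ⟩
        ∑∑ (λ i₁ i₂ → S i₁ i₂ + differ i₁ i₂ * (r * r ^ b + r ^ b * E i₁ i₂))
          ≤⟨ ∑∑-mono-≤ weight-linear ⟩
        ∑∑ (λ i₁ i₂ → r * weight i₁ i₂)
          ≡⟨ ∑∑-*ˡ r weight ⟩
        r * N ∎
        where
        open ≤-Reasoning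
        factor : ∀ d A p E → d * A + p * (d * E) ≡ d * (A + p * E)
        factor = solve-∀
        S = λ i₁ i₂ → same i₁ i₂ * (r * suc r ^ b)
        E = λ i₁ i₂ → ∑[ j < b ] excess j i₁ i₂

      excessⱼ : Fin b → ℕ
      excessⱼ j = ∑∑ (λ i₁ i₂ → differ i₁ i₂ * excess j i₁ i₂)

      ∑differ*free : ∀ j → ∑∑ (λ i₁ i₂ → differ i₁ i₂ * free j (L₁ i₁) (L₂ i₂)) ≡ r * distinct + excessⱼ j
      ∑differ*free j = begin
        ∑∑ (λ i₁ i₂ → differ i₁ i₂ * free j (L₁ i₁) (L₂ i₂))
          ≡⟨ ∑∑-cong (λ i₁ i₂ → trans (cong (differ i₁ i₂ *_) (free≡r+excess j i₁ i₂)) (distribute (differ i₁ i₂) r (excess j i₁ i₂))) ⟩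
        ∑∑ (λ i₁ i₂ → r * differ i₁ i₂ + differ i₁ i₂ * excess j i₁ i₂)
          ≡⟨ ∑∑-distrib-+ (λ i₁ i₂ → r * differ i₁ i₂) (λ i₁ i₂ → differ i₁ i₂ * excess j i₁ i₂) ⟩
        ∑∑ (λ i₁ i₂ → r * differ i₁ i₂) + excessⱼ j
          ≡⟨ cong (_+ excessⱼ j) (∑∑-*ˡ r differ) ⟩
        r * distinct + excessⱼ j ∎
        where
        open ≡-Reasoning
        distribute : ∀ d r e → d * (r + e) ≡ r * d + d * e
        distribute = solve-∀

      excessⱼ-lower : ∀ j → (2 + r) * (2 + r) ≤ excessⱼ j + (2 + r) * common
      excessⱼ-lower j = m²≤Y+m*t r distinct common (sharedAll j) D (excessⱼ j) (shared₁ j + shared₂ j)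
        (subst (λ M → D + sharedAll j ≡ M * common) m≡2+r (∑same*free j))
        (subst (λ M → D + (r * distinct + excessⱼ j) + M * (shared₁ j + shared₂ j) ≡ M * M * M + sharedAll j) m≡2+r total)
        (subst (λ M → shared₁ j + shared₂ j ≤ M + sharedAll j) m≡2+r (shared₁+shared₂≤ j))
        (sharedAll≤common j)
        (subst (λ M → distinct + common ≡ M * M) m≡2+r distinct+common≡m²)
        where
        open ≡-Reasoning
        F = λ i₁ i₂ → free j (L₁ i₁) (L₂ i₂)
        D = ∑∑ (λ i₁ i₂ → same i₁ i₂ * F i₁ i₂)
        total : D + (r * distinct + excessⱼ j) + m * (shared₁ j + shared₂ j) ≡ m * m * m + sharedAll j
        total = begin
          D + (r * distinct + excessⱼ j) + m * (shared₁ j + shared₂ j)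
            ≡⟨ cong₂ _+_ (cong (D +_) (sym (∑differ*free j))) (*-distribˡ-+ m (shared₁ j) (shared₂ j)) ⟩
          D + ∑∑ (λ i₁ i₂ → differ i₁ i₂ * F i₁ i₂) + (m * shared₁ j + m * shared₂ j)
            ≡⟨ cong (_+ (m * shared₁ j + m * shared₂ j)) (sym (split F)) ⟩
          ∑∑ F + (m * shared₁ j + m * shared₂ j)
            ≡⟨ sym (+-assoc (∑∑ F) _ _) ⟩
          ∑∑ F + m * shared₁ j + m * shared₂ j
            ≡⟨ ∑free j ⟩
          m * m * m + sharedAll j ∎

      excessOfDistinct≡∑excessⱼ : excessOfDistinct ≡ ∑[ j < b ] excessⱼ j
      excessOfDistinct≡∑excessⱼ = ∑∑-*-∑ differ excess

      P-K₂≤N-linear : 1 ≤ r → r * suc r ^ b ≤ r * r ^ b + b * (2 + r) * r ^ b → P-K₂ b r ≤ N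
      P-K₂≤N-linear 1≤r hrb = P-K₂≤-linear r b common distinct excessOfDistinct N 1≤r N-linear excess-lower
        (subst (λ M → distinct + common ≡ M * M) m≡2+r distinct+common≡m²) (subst (common ≤_) m≡2+r common≤m) hrb
        where
        open ≤-Reasoning
        excess-lower : b * ((2 + r) * (2 + r)) ≤ excessOfDistinct + b * ((2 + r) * common)
        excess-lower = begin
          b * ((2 + r) * (2 + r))                              ≡⟨ sym (sum-const b _) ⟩
          ∑[ j < b ] ((2 + r) * (2 + r))                       ≤⟨ sum-mono-≤ {b} excessⱼ-lower ⟩
          ∑[ j < b ] (excessⱼ j + (2 + r) * common)            ≡⟨ ∑-distrib-+ excessⱼ (λ _ → (2 + r) * common) ⟩
          ∑[ j < b ] excessⱼ j + ∑[ j < b ] ((2 + r) * common) ≡⟨ cong₂ _+_ (sym excessOfDistinct≡∑excessⱼ) (sum-const b _) ⟩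
          excessOfDistinct + b * ((2 + r) * common)            ∎

      1+r≤free+both : ∀ i₁ i₂ → same i₁ i₂ ≡ 0 → ∀ j → suc r ≤ free j (L₁ i₁) (L₂ i₂) + inL j (L₁ i₁) * inL j (L₂ i₂)
      1+r≤free+both i₁ i₂ same≡0 j = +-cancelʳ-≤ 1 _ _ (begin
        suc r + 1                          ≡⟨ trans (+-comm (suc r) 1) (sym m≡2+r) ⟩
        m                                  ≡⟨ sym (trans (cong (λ x → m + x * a) same≡0) (+-identityʳ m)) ⟩
        m + same i₁ i₂ * a                 ≡⟨ sym (free+inL+inL j (L₁ i₁) (L₂ i₂)) ⟩
        F + a + c                          ≡⟨ +-assoc F a c ⟩
        F + (a + c)                        ≤⟨ +-monoʳ-≤ F (x+y≤1+x*y a c (inL-≤1 j (L₁ i₁)) (inL-≤1 j (L₂ i₂))) ⟩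
        F + (1 + a * c)                    ≡⟨ trans (cong (F +_) (+-comm 1 (a * c))) (sym (+-assoc F (a * c) 1)) ⟩
        F + a * c + 1                      ∎)
        where
        open ≤-Reasoning
        F = free j (L₁ i₁) (L₂ i₂)
        a = inL j (L₁ i₁)
        c = inL j (L₂ i₂)

      -- One colour of L₁ and one of L₂ are not shared; the pair of them is the only distinct pair
      -- that can lose more than a factor r ^ b, and every list containing both of them misses a
      -- common colour, which the Bernoulli bound for the equal pairs pays for.
      module _ (common≡1+r : common ≡ suc r) where

        in₂ in₁ only₁ only₂ : Fin m → ℕ
        in₂ i₁ = ∑[ i₂ < m ] same i₁ i₂
        in₁ i₂ = ∑[ i₁ < m ] same i₁ i₂
        only₁ i₁ = 1 ∸ in₂ i₁
        only₂ i₂ = 1 ∸ in₁ i₂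

        in₂-≤1 : ∀ i₁ → in₂ i₁ ≤ 1
        in₂-≤1 i₁ = subst (_≤ 1) (sum-cong-≗ {m} (λ i₂ → δ-sym (L₂ i₂) (L₁ i₁))) (occurrences-≤1 L₂ L₂-inj (L₁ i₁))

        in₁-≤1 : ∀ i₂ → in₁ i₂ ≤ 1
        in₁-≤1 i₂ = occurrences-≤1 L₁ L₁-inj (L₂ i₂)

        ∑only≡1 : ∀ (f : Fin m → ℕ) → (∀ i → f i ≤ 1) → ∑[ i < m ] f i ≡ common → ∑[ i < m ] (1 ∸ f i) ≡ 1
        ∑only≡1 f f≤1 ∑f≡common = +-cancelˡ-≡ common _ _ (begin
          common + ∑[ i < m ] (1 ∸ f i)           ≡⟨ cong (_+ ∑[ i < m ] (1 ∸ f i)) (sym ∑f≡common) ⟩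
          ∑[ i < m ] f i + ∑[ i < m ] (1 ∸ f i)   ≡⟨ sym (∑-distrib-+ f (λ i → 1 ∸ f i)) ⟩
          ∑[ i < m ] (f i + (1 ∸ f i))            ≡⟨ sum-cong-≗ {m} (λ i → m+[n∸m]≡n (f≤1 i)) ⟩
          ∑[ i < m ] 1                            ≡⟨ trans (sum-const m 1) (*-identityʳ m) ⟩
          m                                       ≡⟨ trans m≡2+r (cong suc (sym common≡1+r)) ⟩
          suc common                              ≡⟨ +-comm 1 common ⟩
          common + 1                              ∎)
          where open ≡-Reasoning

        ∑only₁≡1 : ∑[ i₁ < m ] only₁ i₁ ≡ 1
        ∑only₁≡1 = ∑only≡1 in₂ in₂-≤1 refl

        ∑only₂≡1 : ∑[ i₂ < m ] only₂ i₂ ≡ 1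
        ∑only₂≡1 = ∑only≡1 in₁ in₁-≤1 (sym (∑-comm same))

        special : Fin m → Fin m → ℕ
        special i₁ i₂ = only₁ i₁ * only₂ i₂

        ∑special≡1 : ∑∑ special ≡ 1
        ∑special≡1 = begin
          ∑∑ special                                  ≡⟨ sum-cong-≗ {m} (λ i₁ → sym (*-distribˡ-sum (only₁ i₁) only₂)) ⟩
          ∑[ i₁ < m ] (only₁ i₁ * ∑[ i₂ < m ] only₂ i₂) ≡⟨ sym (*-distribʳ-sum (sum only₂) only₁) ⟩
          sum only₁ * sum only₂                        ≡⟨ cong₂ _*_ ∑only₁≡1 ∑only₂≡1 ⟩
          1                                            ∎
          where open ≡-Reasoning

        special-≤1 : ∀ i₁ i₂ → special i₁ i₂ ≤ 1
        special-≤1 i₁ i₂ = ≤-trans (x*y≤x (only₁ i₁) (only₂ i₂) (m∸n≤m 1 (in₁ i₂))) (m∸n≤m 1 (in₂ i₁))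

        same*special≡0 : ∀ i₁ i₂ → same i₁ i₂ * special i₁ i₂ ≡ 0
        same*special≡0 i₁ i₂ with ≤1⇒≡0⊎≡1 (same-≤1 i₁ i₂)
        ... | inj₁ same≡0 = cong (_* special i₁ i₂) same≡0
        ... | inj₂ same≡1 = trans (cong (_* special i₁ i₂) same≡1) (trans (*-identityˡ _) (cong (_* only₂ i₂) only₁≡0))
          where
          only₁≡0 : only₁ i₁ ≡ 0
          only₁≡0 = cong (1 ∸_) (≤-antisym (in₂-≤1 i₁) (subst (_≤ in₂ i₁) same≡1 (term≤sum (same i₁) i₂)))

        same+special≤1 : ∀ i₁ i₂ → same i₁ i₂ + special i₁ i₂ ≤ 1
        same+special≤1 i₁ i₂ with ≤1⇒≡0⊎≡1 (same-≤1 i₁ i₂)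
        ... | inj₁ same≡0 = subst (λ x → x + special i₁ i₂ ≤ 1) (sym same≡0) (special-≤1 i₁ i₂)
        ... | inj₂ same≡1 = subst₂ (λ x y → x + y ≤ 1) (sym same≡1) (sym special≡0) ≤-refl
          where
          special≡0 : special i₁ i₂ ≡ 0
          special≡0 = trans (sym (*-identityˡ (special i₁ i₂)))
                            (trans (cong (_* special i₁ i₂) (sym same≡1)) (same*special≡0 i₁ i₂))

        other : Fin m → Fin m → ℕ
        other i₁ i₂ = 1 ∸ (same i₁ i₂ + special i₁ i₂)

        ∑other : ∑∑ other + (2 + r) ≡ (2 + r) * (2 + r)
        ∑other = begin
          ∑∑ other + (2 + r)
            ≡⟨ cong (∑∑ other +_) (trans (cong suc (sym common≡1+r)) (trans (+-comm 1 common) (cong (common +_) (sym ∑special≡1)))) ⟩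
          ∑∑ other + (common + ∑∑ special)            ≡⟨ cong (∑∑ other +_) (sym (∑∑-distrib-+ same special)) ⟩
          ∑∑ other + ∑∑ (λ i₁ i₂ → same i₁ i₂ + special i₁ i₂) ≡⟨ sym (∑∑-distrib-+ other (λ i₁ i₂ → same i₁ i₂ + special i₁ i₂)) ⟩
          ∑∑ (λ i₁ i₂ → other i₁ i₂ + (same i₁ i₂ + special i₁ i₂)) ≡⟨ ∑∑-cong (λ i₁ i₂ → m∸n+n≡m (same+special≤1 i₁ i₂)) ⟩
          ∑∑ {m} (λ _ _ → 1)                          ≡⟨ trans (∑∑-const m 1) (cong (m *_) (*-identityʳ m)) ⟩
          m * m                                       ≡⟨ cong (λ x → x * x) m≡2+r ⟩
          (2 + r) * (2 + r)                           ∎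
          where open ≡-Reasoning

        missing : Fin m → ℕ
        missing i₁ = ∑[ j < b ] (1 ∸ inL j (L₁ i₁))

        free-same≡ : ∀ j c → free j c c ≡ suc r + (1 ∸ inL j c)
        free-same≡ j c = x+y≡2+r⇒x≡1+r+[1-y] r (trans (free-same+inL j c) m≡2+r) (inL-≤1 j c)

        weight-diagonal : ∀ i₁ i₂ →
          same i₁ i₂ * (suc r * suc r ^ b + suc r ^ b * missing i₁) + special i₁ i₂ * (suc r * suc r ^ b)
            + other i₁ i₂ * (suc r * r ^ b)
          ≤ suc r * weight i₁ i₂ + special i₁ i₂ * (suc r ^ b * bothIn i₁ i₂)
        weight-diagonal i₁ i₂ = bit-cases-≤ (same i₁ i₂) (special i₁ i₂) _ _ _ _
          (same-≤1 i₁ i₂) (special-≤1 i₁ i₂) (same*special≡0 i₁ i₂) equal-pair special-pair other-pair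
          where
          equal-pair : same i₁ i₂ ≡ 1 → suc r * suc r ^ b + suc r ^ b * missing i₁
                                          ≤ suc r * weight i₁ i₂ + special i₁ i₂ * (suc r ^ b * bothIn i₁ i₂)
          equal-pair same≡1 = ≤-trans (bernoulli (suc r) b (λ j → 1 ∸ inL j (L₁ i₁)))
            (≤-trans (≤-reflexive (cong (suc r *_) (∏-cong (λ j → trans (sym (free-same≡ j (L₁ i₁)))
                                                                         (cong (free j (L₁ i₁)) (δ≡1⇒≡ same≡1))))))
                     (m≤m+n _ _))
          special-pair : same i₁ i₂ ≡ 0 → special i₁ i₂ ≡ 1 → suc r * suc r ^ b
                                          ≤ suc r * weight i₁ i₂ + special i₁ i₂ * (suc r ^ b * bothIn i₁ i₂)
          special-pair same≡0 special≡1 = subst (λ x → suc r * suc r ^ b ≤ suc r * weight i₁ i₂ + x * (suc r ^ b * bothIn i₁ i₂))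
            (sym special≡1)
            (subst (λ x → suc r * suc r ^ b ≤ suc r * weight i₁ i₂ + x) (sym (*-identityˡ _))
              (power≤∏+deficit (suc r) b (λ j → free j (L₁ i₁) (L₂ i₂)) (λ j → inL j (L₁ i₁) * inL j (L₂ i₂))
                (1+r≤free+both i₁ i₂ same≡0)
                (λ j → ≤-trans (x*y≤x _ _ (inL-≤1 j (L₂ i₂))) (inL-≤1 j (L₁ i₁)))))
          other-pair : same i₁ i₂ ≡ 0 → special i₁ i₂ ≡ 0 → suc r * r ^ b
                                          ≤ suc r * weight i₁ i₂ + special i₁ i₂ * (suc r ^ b * bothIn i₁ i₂)
          other-pair _ _ = ≤-trans (*-monoʳ-≤ (suc r) (subst (_≤ weight i₁ i₂) (∏-const b r) (∏-mono-≤ (λ j → r≤free j (L₁ i₁) (L₂ i₂)))))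
                                   (m≤m+n _ _)

        ∑-split : ∀ (f g h : Fin m → ℕ) → (∀ i → f i + g i ≡ 1) → sum h ≡ ∑[ i < m ] (f i * h i) + ∑[ i < m ] (g i * h i)
        ∑-split f g h f+g≡1 = trans (sum-cong-≗ {m} (λ i → begin
            h i                   ≡⟨ sym (*-identityˡ (h i)) ⟩
            1 * h i               ≡⟨ cong (_* h i) (sym (f+g≡1 i)) ⟩
            (f i + g i) * h i     ≡⟨ *-distribʳ-+ (h i) (f i) (g i) ⟩
            f i * h i + g i * h i ∎))
          (∑-distrib-+ (λ i → f i * h i) (λ i → g i * h i))
          where open ≡-Reasoning

        onlyShared₁ onlyShared₂ : Fin b → ℕ
        onlyShared₁ j = ∑[ i₁ < m ] (only₁ i₁ * inL j (L₁ i₁))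
        onlyShared₂ j = ∑[ i₂ < m ] (only₂ i₂ * inL j (L₂ i₂))

        onlyShared₁-≤1 : ∀ j → onlyShared₁ j ≤ 1
        onlyShared₁-≤1 j = ≤-trans (sum-mono-≤ {m} (λ i₁ → x*y≤x (only₁ i₁) _ (inL-≤1 j (L₁ i₁)))) (≤-reflexive ∑only₁≡1)

        onlyShared₂-≤1 : ∀ j → onlyShared₂ j ≤ 1
        onlyShared₂-≤1 j = ≤-trans (sum-mono-≤ {m} (λ i₂ → x*y≤x (only₂ i₂) _ (inL-≤1 j (L₂ i₂)))) (≤-reflexive ∑only₂≡1)

        shared₁≡ : ∀ j → shared₁ j ≡ sharedAll j + onlyShared₁ j
        shared₁≡ j = trans (∑-split in₂ only₁ (λ i₁ → inL j (L₁ i₁)) (λ i₁ → m+[n∸m]≡n (in₂-≤1 i₁)))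
                           (cong (_+ onlyShared₁ j) (sum-cong-≗ {m} (λ i₁ → *-distribʳ-sum (inL j (L₁ i₁)) (same i₁))))

        shared₂≡ : ∀ j → shared₂ j ≡ sharedAll j + onlyShared₂ j
        shared₂≡ j = trans (∑-split in₁ only₂ (λ i₂ → inL j (L₂ i₂)) (λ i₂ → m+[n∸m]≡n (in₁-≤1 i₂)))
                           (cong (_+ onlyShared₂ j) (begin
          ∑[ i₂ < m ] (in₁ i₂ * inL j (L₂ i₂))
            ≡⟨ sum-cong-≗ {m} (λ i₂ → *-distribʳ-sum (inL j (L₂ i₂)) (λ i₁ → same i₁ i₂)) ⟩
          ∑[ i₂ < m ] ∑[ i₁ < m ] (same i₁ i₂ * inL j (L₂ i₂))
            ≡⟨ ∑-comm (λ i₂ i₁ → same i₁ i₂ * inL j (L₂ i₂)) ⟩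
          ∑∑ (λ i₁ i₂ → same i₁ i₂ * inL j (L₂ i₂))
            ≡⟨ ∑∑-cong same*inL₂≡same*inL₁ ⟩
          sharedAll j ∎))
          where
          open ≡-Reasoning
          same*inL₂≡same*inL₁ : ∀ i₁ i₂ → same i₁ i₂ * inL j (L₂ i₂) ≡ same i₁ i₂ * inL j (L₁ i₁)
          same*inL₂≡same*inL₁ i₁ i₂ with L₁ i₁ ≟ L₂ i₂
          ... | yes L₁≡L₂ = cong (λ c → 1 * inL j c) (sym L₁≡L₂)
          ... | no  _     = refl

        ∑special*both≡ : ∀ j → ∑∑ (λ i₁ i₂ → special i₁ i₂ * (inL j (L₁ i₁) * inL j (L₂ i₂))) ≡ onlyShared₁ j * onlyShared₂ j
        ∑special*both≡ j = begin
          ∑∑ (λ i₁ i₂ → special i₁ i₂ * (inL j (L₁ i₁) * inL j (L₂ i₂)))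
            ≡⟨ ∑∑-cong (λ i₁ i₂ → interchange (only₁ i₁) (only₂ i₂) (inL j (L₁ i₁)) (inL j (L₂ i₂))) ⟩
          ∑[ i₁ < m ] ∑[ i₂ < m ] (only₁ i₁ * inL j (L₁ i₁) * (only₂ i₂ * inL j (L₂ i₂)))
            ≡⟨ sum-cong-≗ {m} (λ i₁ → sym (*-distribˡ-sum (only₁ i₁ * inL j (L₁ i₁)) (λ i₂ → only₂ i₂ * inL j (L₂ i₂)))) ⟩
          ∑[ i₁ < m ] (only₁ i₁ * inL j (L₁ i₁) * onlyShared₂ j)
            ≡⟨ sym (*-distribʳ-sum (onlyShared₂ j) (λ i₁ → only₁ i₁ * inL j (L₁ i₁))) ⟩
          onlyShared₁ j * onlyShared₂ j ∎
          where
          open ≡-Reasoning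
          interchange : ∀ a c x z → a * c * (x * z) ≡ a * x * (c * z)
          interchange = solve-∀

        ∑same*missingⱼ : ∀ j → ∑∑ (λ i₁ i₂ → same i₁ i₂ * (1 ∸ inL j (L₁ i₁))) + sharedAll j ≡ common
        ∑same*missingⱼ j = trans (sym (∑∑-distrib-+ (λ i₁ i₂ → same i₁ i₂ * (1 ∸ inL j (L₁ i₁))) (λ i₁ i₂ → same i₁ i₂ * inL j (L₁ i₁))))
          (∑∑-cong (λ i₁ i₂ → trans (sym (*-distribˡ-+ (same i₁ i₂) _ _))
                                    (trans (cong (same i₁ i₂ *_) (m∸n+n≡m (inL-≤1 j (L₁ i₁)))) (*-identityʳ _))))

        -- Every list Lⱼ containing both unshared colours misses one of the common ones.
        both≤missingⱼ : ∀ j → ∑∑ (λ i₁ i₂ → special i₁ i₂ * (inL j (L₁ i₁) * inL j (L₂ i₂)))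
                               ≤ ∑∑ (λ i₁ i₂ → same i₁ i₂ * (1 ∸ inL j (L₁ i₁)))
        both≤missingⱼ j = +-cancelʳ-≤ (sharedAll j) _ _ (begin
          ∑∑ (λ i₁ i₂ → special i₁ i₂ * (inL j (L₁ i₁) * inL j (L₂ i₂))) + sharedAll j ≡⟨ cong (_+ sharedAll j) (∑special*both≡ j) ⟩
          onlyShared₁ j * onlyShared₂ j + sharedAll j
            ≤⟨ a*b+s≤t (sharedAll j) (onlyShared₁ j) (onlyShared₂ j) common (onlyShared₁-≤1 j) (onlyShared₂-≤1 j) (sharedAll≤common j) fits ⟩
          common                                           ≡⟨ sym (∑same*missingⱼ j) ⟩
          ∑∑ (λ i₁ i₂ → same i₁ i₂ * (1 ∸ inL j (L₁ i₁))) + sharedAll j ∎)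
          where
          open ≤-Reasoning
          fits : (sharedAll j + onlyShared₁ j) + (sharedAll j + onlyShared₂ j) ≤ suc common + sharedAll j
          fits = subst₂ (λ x y → x + y ≤ suc common + sharedAll j) (shared₁≡ j) (shared₂≡ j)
                   (subst (λ M → shared₁ j + shared₂ j ≤ M + sharedAll j) (trans m≡2+r (cong suc (sym common≡1+r))) (shared₁+shared₂≤ j))

        P-K₂≤N-diagonal : P-K₂ b r ≤ N
        P-K₂≤N-diagonal = P-K₂≤-diagonal r b EB FW (∑∑ other) N ∑other summed FW≤EB
          where
          open ≤-Reasoning
          R₁ = suc r ^ b
          X = suc r * R₁
          Y = suc r * r ^ b
          EB = ∑∑ (λ i₁ i₂ → same i₁ i₂ * missing i₁)
          FW = ∑∑ (λ i₁ i₂ → special i₁ i₂ * bothIn i₁ i₂)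
          S Sp O : Fin m → Fin m → ℕ
          S i₁ i₂ = same i₁ i₂ * (X + R₁ * missing i₁)
          Sp i₁ i₂ = special i₁ i₂ * X
          O i₁ i₂ = other i₁ i₂ * Y
          regroup : ∀ e X p M → e * (X + p * M) ≡ e * X + p * (e * M)
          regroup = solve-∀
          reorder : ∀ f p B → f * (p * B) ≡ p * (f * B)
          reorder = solve-∀

          FW≤EB : FW ≤ EB
          FW≤EB = subst₂ _≤_ (sym (∑∑-*-∑ special (λ j i₁ i₂ → inL j (L₁ i₁) * inL j (L₂ i₂))))
                             (sym (∑∑-*-∑ same (λ j i₁ i₂ → 1 ∸ inL j (L₁ i₁))))
                             (sum-mono-≤ {b} both≤missingⱼ)

          ∑S : ∑∑ S ≡ suc r * X + R₁ * EB
          ∑S = begin-equality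
            ∑∑ S                                                     ≡⟨ ∑∑-cong (λ i₁ i₂ → regroup (same i₁ i₂) X R₁ (missing i₁)) ⟩
            ∑∑ (λ i₁ i₂ → same i₁ i₂ * X + R₁ * (same i₁ i₂ * missing i₁))
              ≡⟨ ∑∑-distrib-+ (λ i₁ i₂ → same i₁ i₂ * X) (λ i₁ i₂ → R₁ * (same i₁ i₂ * missing i₁)) ⟩
            ∑∑ (λ i₁ i₂ → same i₁ i₂ * X) + ∑∑ (λ i₁ i₂ → R₁ * (same i₁ i₂ * missing i₁))
              ≡⟨ cong₂ _+_ (trans (∑∑-*ʳ X same) (cong (_* X) common≡1+r)) (∑∑-*ˡ R₁ (λ i₁ i₂ → same i₁ i₂ * missing i₁)) ⟩
            suc r * X + R₁ * EB                                      ∎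

          summed : suc r * X + R₁ * EB + 1 * X + ∑∑ other * Y ≤ suc r * N + R₁ * FW
          summed = begin
            suc r * X + R₁ * EB + 1 * X + ∑∑ other * Y
              ≡⟨ cong₂ (λ x y → x + y + ∑∑ other * Y) (sym ∑S) (trans (cong (_* X) (sym ∑special≡1)) (sym (∑∑-*ʳ X special))) ⟩
            ∑∑ S + ∑∑ Sp + ∑∑ other * Y
              ≡⟨ cong₂ _+_ (sym (∑∑-distrib-+ S Sp)) (sym (∑∑-*ʳ Y other)) ⟩
            ∑∑ (λ i₁ i₂ → S i₁ i₂ + Sp i₁ i₂) + ∑∑ O
              ≡⟨ sym (∑∑-distrib-+ (λ i₁ i₂ → S i₁ i₂ + Sp i₁ i₂) O) ⟩
            ∑∑ (λ i₁ i₂ → S i₁ i₂ + Sp i₁ i₂ + O i₁ i₂)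
              ≤⟨ ∑∑-mono-≤ weight-diagonal ⟩
            ∑∑ (λ i₁ i₂ → suc r * weight i₁ i₂ + special i₁ i₂ * (R₁ * bothIn i₁ i₂))
              ≡⟨ ∑∑-distrib-+ (λ i₁ i₂ → suc r * weight i₁ i₂) (λ i₁ i₂ → special i₁ i₂ * (R₁ * bothIn i₁ i₂)) ⟩
            ∑∑ (λ i₁ i₂ → suc r * weight i₁ i₂) + ∑∑ (λ i₁ i₂ → special i₁ i₂ * (R₁ * bothIn i₁ i₂))
              ≡⟨ cong₂ _+_ (∑∑-*ˡ (suc r) weight)
                           (trans (∑∑-cong (λ i₁ i₂ → reorder (special i₁ i₂) R₁ (bothIn i₁ i₂)))
                                  (∑∑-*ˡ R₁ (λ i₁ i₂ → special i₁ i₂ * bothIn i₁ i₂))) ⟩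
            suc r * N + R₁ * FW ∎

    -- For m = 3 a distinct pair has weight at least 2 ^ (b - d), d the number of lists containing both
    -- colours; a tangent line v - c d of this convex function is summed against the bound on ∑ d.
    module _ (m≡3 : m ≡ 3) (c v : ℕ) (tangent : ∀ w d → 2 ^ b ≤ w * 2 ^ d → v ≤ w + c * d) where

      weight-m≡3 : ∀ i₁ i₂ → same i₁ i₂ * 2 ^ b + differ i₁ i₂ * v ≤ weight i₁ i₂ + c * (differ i₁ i₂ * bothIn i₁ i₂)
      weight-m≡3 i₁ i₂ with L₁ i₁ ≟ L₂ i₂ | weight-lower 1 m≡3 i₁ i₂
      ... | yes _     | lower = ≤-trans lower (m≤m+n _ _)
      ... | no  L₁≢L₂ | _     = subst₂ _≤_ (sym (*-identityˡ v)) (cong (λ x → weight i₁ i₂ + c * x) (sym (*-identityˡ (bothIn i₁ i₂))))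
        (tangent (weight i₁ i₂) (bothIn i₁ i₂)
          (2^n≤∏*2^∑ b (λ j → free j (L₁ i₁) (L₂ i₂)) (λ j → inL j (L₁ i₁) * inL j (L₂ i₂))
            (1+r≤free+both 1 m≡3 i₁ i₂ (δ-≢ L₁≢L₂))
            (λ j → ≤-trans (x*y≤x _ _ (inL-≤1 j (L₂ i₂))) (inL-≤1 j (L₁ i₁)))))

      bothⱼ : Fin b → ℕ
      bothⱼ j = ∑∑ (λ i₁ i₂ → differ i₁ i₂ * (inL j (L₁ i₁) * inL j (L₂ i₂)))

      bothⱼ+sharedAll≡ : ∀ j → bothⱼ j + sharedAll j ≡ shared₁ j * shared₂ j
      bothⱼ+sharedAll≡ j = begin
        bothⱼ j + sharedAll j
          ≡⟨ +-comm (bothⱼ j) (sharedAll j) ⟩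
        sharedAll j + bothⱼ j
          ≡⟨ cong (_+ bothⱼ j) (sym (∑∑-cong same*both≡same*inL₁)) ⟩
        ∑∑ (λ i₁ i₂ → same i₁ i₂ * (inL j (L₁ i₁) * inL j (L₂ i₂))) + bothⱼ j
          ≡⟨ sym (split (λ i₁ i₂ → inL j (L₁ i₁) * inL j (L₂ i₂))) ⟩
        ∑∑ (λ i₁ i₂ → inL j (L₁ i₁) * inL j (L₂ i₂))
          ≡⟨ sum-cong-≗ {m} (λ i₁ → sym (*-distribˡ-sum (inL j (L₁ i₁)) (λ i₂ → inL j (L₂ i₂)))) ⟩
        ∑[ i₁ < m ] (inL j (L₁ i₁) * shared₂ j)
          ≡⟨ sym (*-distribʳ-sum (shared₂ j) (λ i₁ → inL j (L₁ i₁))) ⟩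
        shared₁ j * shared₂ j ∎
        where
        open ≡-Reasoning
        same*both≡same*inL₁ : ∀ i₁ i₂ → same i₁ i₂ * (inL j (L₁ i₁) * inL j (L₂ i₂)) ≡ same i₁ i₂ * inL j (L₁ i₁)
        same*both≡same*inL₁ i₁ i₂ with L₁ i₁ ≟ L₂ i₂
        ... | no  _     = refl
        ... | yes L₁≡L₂ = cong (1 *_) (trans (cong (λ c → inL j (L₁ i₁) * inL j c) (sym L₁≡L₂))
                                             (idem (inL j (L₁ i₁)) (inL-≤1 j (L₁ i₁))))
          where
          idem : ∀ x → x ≤ 1 → x * x ≡ x
          idem x x≤1 with ≤1⇒≡0⊎≡1 x≤1
          ... | inj₁ refl = refl
          ... | inj₂ refl = refl

      N-lower-m≡3 : common ≤ 1 → common * 2 ^ b + distinct * v ≤ N + c * (b * (2 + common))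
      N-lower-m≡3 common≤1 = begin
        common * 2 ^ b + distinct * v
          ≡⟨ sym (trans (∑∑-distrib-+ (λ i₁ i₂ → same i₁ i₂ * 2 ^ b) (λ i₁ i₂ → differ i₁ i₂ * v))
                        (cong₂ _+_ (∑∑-*ʳ (2 ^ b) same) (∑∑-*ʳ v differ))) ⟩
        ∑∑ (λ i₁ i₂ → same i₁ i₂ * 2 ^ b + differ i₁ i₂ * v)
          ≤⟨ ∑∑-mono-≤ weight-m≡3 ⟩
        ∑∑ (λ i₁ i₂ → weight i₁ i₂ + c * (differ i₁ i₂ * bothIn i₁ i₂))
          ≡⟨ ∑∑-distrib-+ weight (λ i₁ i₂ → c * (differ i₁ i₂ * bothIn i₁ i₂)) ⟩
        N + ∑∑ (λ i₁ i₂ → c * (differ i₁ i₂ * bothIn i₁ i₂))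
          ≡⟨ cong (N +_) (trans (∑∑-*ˡ c (λ i₁ i₂ → differ i₁ i₂ * bothIn i₁ i₂))
                                (cong (c *_) (∑∑-*-∑ differ (λ j i₁ i₂ → inL j (L₁ i₁) * inL j (L₂ i₂))))) ⟩
        N + c * ∑[ j < b ] bothⱼ j
          ≤⟨ +-monoʳ-≤ N (*-monoʳ-≤ c (≤-trans (sum-mono-≤ {b} bothⱼ≤) (≤-reflexive (sum-const b (2 + common))))) ⟩
        N + c * (b * (2 + common)) ∎
        where
        open ≤-Reasoning
        bothⱼ≤ : ∀ j → bothⱼ j ≤ 2 + common
        bothⱼ≤ j = κ+s≡a*c⇒κ≤2+t (bothⱼ j) (sharedAll j) (shared₁ j) (shared₂ j) common (bothⱼ+sharedAll≡ j)
          (subst (λ M → shared₁ j + shared₂ j ≤ M + sharedAll j) m≡3 (shared₁+shared₂≤ j)) (sharedAll≤common j) common≤1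

  module _ (L₁ L₂ : Fin 2 → A) (Lⱼ : Fin 3 → Fin 2 → A) (L₁-inj : Injective _≡_ _≡_ L₁) (L₂-inj : Injective _≡_ _≡_ L₂)
           (Lⱼ-inj : ∀ j → Injective _≡_ _≡_ (Lⱼ j)) where
    open ListsOnK₂ 2 3 L₁ L₂ Lⱼ L₁-inj L₂-inj Lⱼ-inj

    P-K₂≤N-no-common : common ≡ 0 → P-K₂ 3 0 ≤ N
    P-K₂≤N-no-common common≡0 = subst (2 ≤_) (sym N≡N₂,₃) (2≤N₂,₃ (bit L₁) (bit L₂) admissible)
      where
      bit : (Fin 2 → A) → Fin 3 → Fin 2 → Fin 2
      bit L j i = fromℕ< (s≤s (inL-≤1 j (L i)))
      bit-inL : ∀ L j i → bits (bit L) j i ≡ inL j (L i)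
      bit-inL L j i = toℕ-fromℕ< (s≤s (inL-≤1 j (L i)))
      same≡0 : ∀ i₁ i₂ → same i₁ i₂ ≡ 0
      same≡0 i₁ i₂ = n≤0⇒n≡0 (begin
        same i₁ i₂ ≤⟨ term≤sum (same i₁) i₂ ⟩
        sum (same i₁) ≤⟨ term≤sum (λ i → sum (same i)) i₁ ⟩
        common ≡⟨ common≡0 ⟩
        0 ∎)
        where open ≤-Reasoning
      free≡ : ∀ j i₁ i₂ → free j (L₁ i₁) (L₂ i₂) ≡ 2 ∸ (inL j (L₁ i₁) + inL j (L₂ i₂))
      free≡ j i₁ i₂ = sym (trans (cong (_∸ (a + c)) (sym F+a+c≡2)) (m+n∸n≡m F (a + c)))
        where
        F = free j (L₁ i₁) (L₂ i₂)
        a = inL j (L₁ i₁)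
        c = inL j (L₂ i₂)
        F+a+c≡2 : F + (a + c) ≡ 2
        F+a+c≡2 = trans (sym (+-assoc F a c)) (trans (free+inL+inL j (L₁ i₁) (L₂ i₂)) (cong (λ x → 2 + x * a) (same≡0 i₁ i₂)))
      N≡N₂,₃ : N ≡ N₂,₃ (bits (bit L₁)) (bits (bit L₂))
      N≡N₂,₃ = ∑∑-cong (λ i₁ i₂ → ∏-cong (λ j → trans (free≡ j i₁ i₂)
                 (sym (cong₂ (λ x y → 2 ∸ (x + y)) (bit-inL L₁ j i₁) (bit-inL L₂ j i₂)))))
      admissible : AdmissibleRows (bits (bit L₁)) (bits (bit L₂))
      admissible j = begin
        bits (bit L₁) j zero + bits (bit L₁) j (suc zero) + (bits (bit L₂) j zero + bits (bit L₂) j (suc zero))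
          ≡⟨ cong₂ _+_ (cong₂ _+_ (bit-inL L₁ j zero) (bit-inL L₁ j (suc zero))) (cong₂ _+_ (bit-inL L₂ j zero) (bit-inL L₂ j (suc zero))) ⟩
        inL j (L₁ zero) + inL j (L₁ (suc zero)) + (inL j (L₂ zero) + inL j (L₂ (suc zero)))
          ≡⟨ cong₂ _+_ (cong (inL j (L₁ zero) +_) (sym (+-identityʳ _))) (cong (inL j (L₂ zero) +_) (sym (+-identityʳ _))) ⟩
        shared₁ j + shared₂ j
          ≤⟨ shared₁+shared₂≤ j ⟩
        2 + sharedAll j
          ≤⟨ +-monoʳ-≤ 2 (≤-trans (sharedAll≤common j) (≤-reflexive common≡0)) ⟩
        2 + 0 ∎
        where open ≤-Reasoning

  N-single-list : ∀ r b (ℓ : Fin (2 + r) → A) (inj : Injective _≡_ _≡_ ℓ) →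
                  ListsOnK₂.N (2 + r) b ℓ ℓ (λ _ → ℓ) inj inj (λ _ → inj) ≡ P-K₂ b r
  N-single-list r b ℓ inj = begin
    N                                      ≡⟨ N-covered r refl (λ j → occurrences-self ℓ inj) (λ j → occurrences-self ℓ inj) ⟩
    common * suc r ^ b + distinct * r ^ b  ≡⟨ cong₂ (λ t Q → t * suc r ^ b + Q * r ^ b) common≡m (distinct≡ r refl common≡m) ⟩
    P-K₂ b r                               ∎
    where
    open ListsOnK₂ (2 + r) b ℓ ℓ (λ _ → ℓ) inj inj (λ _ → inj)
    open ≡-Reasoning
    common≡m : common ≡ 2 + r
    common≡m = begin
      common                                ≡⟨ ∑∑-cong (λ i₁ i₂ → δ-sym (ℓ i₁) (ℓ i₂)) ⟩
      ∑[ i₁ < 2 + r ] occurrences ℓ (ℓ i₁)  ≡⟨ sum-cong-≗ {2 + r} (occurrences-self ℓ inj) ⟩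
      ∑[ i₁ < 2 + r ] 1                     ≡⟨ trans (sum-const (2 + r) 1) (*-identityʳ (2 + r)) ⟩
      2 + r                                 ∎

module _ {b r : ℕ} (L : ListAssignment (K 2 b) (2 + r)) where
  open ListsOnK₂ Data.Nat._≟_ (2 + r) b (proj₁ L zero) (proj₁ L (suc zero)) (λ j → proj₁ L (suc (suc j)))
                 (proj₂ L zero) (proj₂ L (suc zero)) (λ j → proj₂ L (suc (suc j)))
    public

  numLColorings≡N : numLColorings (K 2 b) (2 + r) L ≡ N
  numLColorings≡N = count-proper-K₂ Data.Nat._≟_ b (2 + r) (proj₁ L)

P≡P-K₂ : ∀ b r → P (K 2 b) (2 + r) ≡ P-K₂ b r
P≡P-K₂ b r = trans (count-proper-K₂ Data.Fin._≟_ b (2 + r) (λ _ k → k)) (N-single-list Data.Fin._≟_ r b (λ k → k) (λ e → e))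

standard : ∀ b m → ListAssignment (K 2 b) m
standard b m = (λ _ → toℕ) , (λ _ → toℕ-injective)

numLColorings-standard : ∀ b r → numLColorings (K 2 b) (2 + r) (standard b (2 + r)) ≡ P-K₂ b r
numLColorings-standard b r = trans (count-proper-K₂ Data.Nat._≟_ b (2 + r) (λ _ → toℕ)) (N-single-list Data.Nat._≟_ r b toℕ toℕ-injective)

agrees : ∀ b r → (∀ L → P-K₂ b r ≤ N L) → Agrees (K 2 b) (2 + r)
agrees b r P-K₂≤N = (standard b (2 + r) , trans (numLColorings-standard b r) (sym (P≡P-K₂ b r)))
                  , λ L → subst₂ _≤_ (sym (P≡P-K₂ b r)) (sym (numLColorings≡N L)) (P-K₂≤N L)

agrees-K₂,₃ : ∀ r → Agrees (K 2 3) (2 + r)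
agrees-K₂,₃ (suc x) = agrees 3 (suc x) λ L → P-K₂≤N-linear L (suc x) refl (s≤s z≤n) (slack₃ x)
agrees-K₂,₃ zero    = agrees 3 0 λ L → by-common L (≤2+r-cases 0 (common≤m L))
  where
  by-common : ∀ L → common L ≡ 2 ⊎ common L ≡ 1 ⊎ common L ≤ 0 → P-K₂ 3 0 ≤ N L
  by-common L (inj₁ all-common)        = P-K₂≤N-all-common L 0 refl all-common
  by-common L (inj₂ (inj₁ one-missing)) = P-K₂≤N-diagonal L 0 refl one-missing
  by-common L (inj₂ (inj₂ none))       = P-K₂≤N-no-common Data.Nat._≟_ (proj₁ L zero) (proj₁ L (suc zero))
    (λ j → proj₁ L (suc (suc j))) (proj₂ L zero) (proj₂ L (suc zero)) (λ j → proj₂ L (suc (suc j))) (n≤0⇒n≡0 none)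

module _ (b c v : ℕ) (tangent : ∀ w d → 2 ^ b ≤ w * 2 ^ d → v ≤ w + c * d)
         (case₀ : ∀ N → 9 * v ≤ N + c * (b * 2) → P-K₂ b 1 ≤ N)
         (case₁ : ∀ N → 2 ^ b + 8 * v ≤ N + c * (b * 3) → P-K₂ b 1 ≤ N) where

  agrees-m≡3 : Agrees (K 2 b) 3
  agrees-m≡3 = agrees b 1 λ L → by-common L (≤2+r-cases 1 (common≤m L))
    where
    by-common : ∀ L → common L ≡ 3 ⊎ common L ≡ 2 ⊎ common L ≤ 1 → P-K₂ b 1 ≤ N L
    by-common L (inj₁ all-common)        = P-K₂≤N-all-common L 1 refl all-common
    by-common L (inj₂ (inj₁ one-missing)) = P-K₂≤N-diagonal L 1 refl one-missing
    by-common L (inj₂ (inj₂ common≤1))   = P-K₂≤-m≡3 b c v (common L) (distinct L) (N L) common≤1 (distinct+common≡m² L)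
      (case₀ (N L)) (case₁ (N L)) (N-lower-m≡3 L refl c v tangent common≤1)

agrees-K₂,₄ : ∀ r → Agrees (K 2 4) (3 + r)
agrees-K₂,₄ (suc x) = agrees 4 (2 + x) λ L → P-K₂≤N-linear L (2 + x) refl (s≤s z≤n) (slack₄ x)
agrees-K₂,₄ zero    = agrees-m≡3 4 4 12 tangent₄
  (λ N h → ≤-trans (m≤m+n 54 22) (+-cancelʳ-≤ 32 76 N h))
  (λ N h → ≤-trans (m≤m+n 54 10) (+-cancelʳ-≤ 48 64 N h))

agrees-K₂,₅ : ∀ r → Agrees (K 2 5) (3 + r)
agrees-K₂,₅ (suc x) = agrees 5 (2 + x) λ L → P-K₂≤N-linear L (2 + x) refl (s≤s z≤n) (slack₅ x)
agrees-K₂,₅ zero    = agrees-m≡3 5 8 24 tangent₅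
  (λ N h → ≤-trans (m≤m+n 102 34) (+-cancelʳ-≤ 80 136 N h))
  (λ N h → ≤-trans (m≤m+n 102 2) (+-cancelʳ-≤ 120 104 N h))

agreesFrom : ∀ {G} k → (∀ r → Agrees G (k + r)) → AgreesFrom G k
agreesFrom {G} k agrees-k+ m k≤m = subst (Agrees G) (m+[n∸m]≡n k≤m) (agrees-k+ (m ∸ k))

threshold-above : ∀ {G m k} (L : ListAssignment G m) → numLColorings G m L < P G m → AgreesFrom G k → m < k
threshold-above {m = m} {k} L fewer agreesFrom-k with k ≤? m
... | yes k≤m = contradiction (proj₂ (agreesFrom-k m k≤m) L) (<⇒≱ fewer)
... | no  k≰m = ≰⇒> k≰m

χ-K₂ : ∀ b → IsChromaticNumber (K 2 (suc b)) 2
χ-K₂ b = (bipartition , proj₂ (proper-K₂⇔ Data.Fin._≟_ (suc b) bipartition) (λ j → (λ ()) , (λ ()))) , two≤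
  where
  bipartition : Fin (2 + suc b) → Fin 2
  bipartition zero          = zero
  bipartition (suc zero)    = zero
  bipartition (suc (suc _)) = suc zero
  two≤ : ∀ m → Colorable (K 2 (suc b)) m → 2 ≤ m
  two≤ 0               (f , _)      with () ← f zero
  two≤ 1               (f , proper) = contradiction (single (f (suc (suc zero))) (f zero)) (proper (suc (suc zero)) zero tt)
    where
    single : (x y : Fin 1) → x ≡ y
    single zero zero = refl
  two≤ (suc (suc m)) _ = s≤s (s≤s z≤n)

-- Every pair in {1,2} × {3,4} is the list of some vertex 2 + j, so no choice for 0 and 1 extends.
blocking : ∀ k → ListAssignment (K 2 (4 + k)) 2
blocking k = lists , injective
  where
  pair : ℕ → ℕ → Fin 2 → ℕ
  pair x y zero    = x
  pair x y (suc _) = y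
  pair-injective : ∀ {x y} → x ≢ y → Injective _≡_ _≡_ (pair x y)
  pair-injective x≢y {zero}     {zero}     _ = refl
  pair-injective x≢y {zero}     {suc zero} e = contradiction e x≢y
  pair-injective x≢y {suc zero} {zero}     e = contradiction (sym e) x≢y
  pair-injective x≢y {suc zero} {suc zero} _ = refl
  lists : Fin (6 + k) → Fin 2 → ℕ
  lists zero                                = pair 1 2
  lists (suc zero)                          = pair 3 4
  lists (suc (suc zero))                    = pair 1 3
  lists (suc (suc (suc zero)))              = pair 1 4
  lists (suc (suc (suc (suc zero))))        = pair 2 3
  lists (suc (suc (suc (suc (suc _)))))     = pair 2 4
  injective : ∀ v → Injective _≡_ _≡_ (lists v)
  injective zero                            = pair-injective (λ ())
  injective (suc zero)                      = pair-injective (λ ())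
  injective (suc (suc zero))                = pair-injective (λ ())
  injective (suc (suc (suc zero)))          = pair-injective (λ ())
  injective (suc (suc (suc (suc zero))))    = pair-injective (λ ())
  injective (suc (suc (suc (suc (suc _))))) = pair-injective (λ ())

IsTau-3 : ∀ k → numLColorings (K 2 (4 + k)) 2 (blocking k) < P (K 2 (4 + k)) 2 →
          (∀ r → Agrees (K 2 (4 + k)) (3 + r)) → IsTau (K 2 (4 + k)) 3
IsTau-3 k blocked agrees-3+ =
  2 , χ-K₂ (3 + k) , s≤s (s≤s (z≤n {1})) , agreesFrom {K 2 (4 + k)} 3 agrees-3+ ,
  λ k' _ agreesFrom-k' → threshold-above {K 2 (4 + k)} (blocking k) blocked agreesFrom-k'

corollary19 : IsTau (K 2 3) 2 × IsTau (K 2 4) 3 × IsTau (K 2 5) 3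
corollary19 =
  (2 , χ-K₂ 2 , ≤-refl , agreesFrom {K 2 3} 2 agrees-K₂,₃ , λ _ 2≤k' _ → 2≤k') ,
  -- by evaluation, the blocking lists admit 0 < 2 = P (K 2 b) 2 colourings
  IsTau-3 0 (s≤s (z≤n {1})) agrees-K₂,₄ ,
  IsTau-3 1 (s≤s (z≤n {1})) agrees-K₂,₅
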